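{- Let $\mathcal{T}$ be a triangulation of the annulus $C_{m,n}$ with $k$ peripheral arcs, of which $k_1$ have their endpoints on the boundary component with $m$ marked points and $k_2$ on the boundary component with $n$ marked points (so $k_1+k_2=k$). Then the skeletal triangulation $\mathcal{T}^s$ is a triangulation of the annulus $C_{m-k_1,n-k_2}$.
   Context: $C_{m,n}$ denotes an annulus with $m$ marked points on one boundary component and $n$ on the other. Arcs are homotopy classes of simple curves between marked points meeting the boundary only at endpoints and not contractible into the boundary; triangulations are maximal collections of pairwise non-crossing arcs (finite arcs only). Peripheral arcs have both endpoints on the same component; bridging arcs join different components. The flip of an arc replaces it by the other diagonal of the quadrilateral formed by its two incident triangles. A bounding arc is a peripheral arc whose flip is bridging; it splits the annulus into a triangulated polygon and a triangulated annulus. The skeletal triangulation $\mathcal{T}^s$ is obtained by cutting along all bounding arcs and removing the triangulated polygons attached to them (the result is a triangulation of a smaller annulus). -}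

module Defs where

open import Data.Nat as ℕ using (ℕ; zero; suc; NonZero)
open import Data.Integer as ℤ using (ℤ; +_)
open import Data.Integer.DivMod using (_/ℕ_; _%ℕ_)
open import Data.Fin using (Fin; toℕ)
open import Data.Vec using (Vec; []; _∷_)
open import Data.Bool using (true; false)
open import Data.List using (List)
open import Data.List.Membership.Propositional using (_∈_)
open import Data.List.Relation.Unary.Unique.Propositional using (Unique)
open import Data.Fin.Subset as Sub using (Subset)
open import Data.Product using (Σ; ∃; _×_; _,_)
open import Data.Sum using (_⊎_)
open import Data.Empty using (⊥)
open import Data.Unit using (⊤)
open import Relation.Nullary using (¬_)
open import Relation.Binary.PropositionalEquality using (_≡_; _≢_)

-- Combinatorial model of the annulus C_{m,n} via its universal cover
-- (an infinite strip).  Marked points on the "outer" component (the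
-- one with m marked points) lift to the integers on the upper line,
-- marked points on the other component lift to the integers on the
-- lower line; both lines are oriented the same way and the deck
-- transformation is (i , j) ↦ (i + m , j + n).
--
-- Homotopy classes of arcs, with canonical representatives:
--  * outer a d : peripheral arc on the m-component, lift from a to a+d
--                (2 ≤ d ≤ m; d = 1 is a boundary segment, d > m is
--                not simple);
--  * inner b d : peripheral arc on the n-component, likewise;
--  * bridge a j : bridging arc, lift from the upper point a (0 ≤ a < m)
--                 to the lower point j ∈ ℤ.

data Arc (m n : ℕ) : Set where
  outer  : (a : Fin m) (d : ℕ) → .(2 ℕ.≤ d) → .(d ℕ.≤ m) → Arc m n
  inner  : (b : Fin n) (d : ℕ) → .(2 ℕ.≤ d) → .(d ℕ.≤ n) → Arc m n
  bridge : (a : Fin m) (j : ℤ) → Arc m n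

Interleave : ℤ → ℤ → ℤ → ℤ → Set
Interleave x y x' y' =
  (x ℤ.< x' × x' ℤ.< y × y ℤ.< y') ⊎ (x' ℤ.< x × x ℤ.< y' × y' ℤ.< y)

-- two arcs cross iff some of their lifts cross in the strip
Cross : {m n : ℕ} → Arc m n → Arc m n → Set
Cross {m} {n} (outer a d _ _) (outer a' d' _ _) =
  ∃ λ (k : ℤ) → Interleave (+ toℕ a) (+ toℕ a ℤ.+ + d)
                           (+ toℕ a' ℤ.+ k ℤ.* + m) (+ toℕ a' ℤ.+ k ℤ.* + m ℤ.+ + d')
Cross {m} {n} (inner b d _ _) (inner b' d' _ _) =
  ∃ λ (k : ℤ) → Interleave (+ toℕ b) (+ toℕ b ℤ.+ + d)
                           (+ toℕ b' ℤ.+ k ℤ.* + n) (+ toℕ b' ℤ.+ k ℤ.* + n ℤ.+ + d')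
Cross {m} {n} (outer a d _ _) (bridge a' j) =
  ∃ λ (k : ℤ) → (+ toℕ a ℤ.< + toℕ a' ℤ.+ k ℤ.* + m) × (+ toℕ a' ℤ.+ k ℤ.* + m ℤ.< + toℕ a ℤ.+ + d)
Cross {m} {n} (bridge a' j) (outer a d _ _) =
  ∃ λ (k : ℤ) → (+ toℕ a ℤ.< + toℕ a' ℤ.+ k ℤ.* + m) × (+ toℕ a' ℤ.+ k ℤ.* + m ℤ.< + toℕ a ℤ.+ + d)
Cross {m} {n} (inner b d _ _) (bridge a j) =
  ∃ λ (k : ℤ) → (+ toℕ b ℤ.< j ℤ.+ k ℤ.* + n) × (j ℤ.+ k ℤ.* + n ℤ.< + toℕ b ℤ.+ + d)
Cross {m} {n} (bridge a j) (inner b d _ _) =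
  ∃ λ (k : ℤ) → (+ toℕ b ℤ.< j ℤ.+ k ℤ.* + n) × (j ℤ.+ k ℤ.* + n ℤ.< + toℕ b ℤ.+ + d)
Cross {m} {n} (bridge a j) (bridge a' j') =
  ∃ λ (k : ℤ) →
    let i' = + toℕ a' ℤ.+ k ℤ.* + m ; l' = j' ℤ.+ k ℤ.* + n in
    (+ toℕ a ℤ.< i' × l' ℤ.< j) ⊎ (i' ℤ.< + toℕ a × j ℤ.< l')
Cross (outer _ _ _ _) (inner _ _ _ _) = ⊥
Cross (inner _ _ _ _) (outer _ _ _ _) = ⊥

Compatible : {m n : ℕ} → Arc m n → Arc m n → Set
Compatible σ τ = ¬ Cross σ τ

IsPeripheral : {m n : ℕ} → Arc m n → Set
IsPeripheral (outer _ _ _ _) = ⊤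
IsPeripheral (inner _ _ _ _) = ⊤
IsPeripheral (bridge _ _)    = ⊥

IsBridging : {m n : ℕ} → Arc m n → Set
IsBridging (bridge _ _) = ⊤
IsBridging (outer _ _ _ _) = ⊥
IsBridging (inner _ _ _ _) = ⊥

IsTriangulationP : {m n : ℕ} → (Arc m n → Set) → Set
IsTriangulationP {m} {n} P =
  (∀ σ τ → P σ → P τ → Compatible σ τ) ×
  (∀ (γ : Arc m n) → (∀ τ → P τ → Compatible γ τ) → P γ)

IsTriangulation : {m n : ℕ} → List (Arc m n) → Set
IsTriangulation T = Unique T × IsTriangulationP (λ σ → σ ∈ T)

countOuter : {m n : ℕ} → List (Arc m n) → ℕ
countOuter List.[] = 0
countOuter (outer _ _ _ _ List.∷ T) = suc (countOuter T)
countOuter (inner _ _ _ _ List.∷ T) = countOuter T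
countOuter (bridge _ _ List.∷ T) = countOuter T

countInner : {m n : ℕ} → List (Arc m n) → ℕ
countInner List.[] = 0
countInner (outer _ _ _ _ List.∷ T) = countInner T
countInner (inner _ _ _ _ List.∷ T) = suc (countInner T)
countInner (bridge _ _ List.∷ T) = countInner T

-- σ' is the flip of σ ∈ T: the arc σ' ≠ σ such that (T ∖ {σ}) ∪ {σ'}
-- is again a triangulation (the other diagonal of the quadrilateral)
IsFlip : {m n : ℕ} → List (Arc m n) → Arc m n → Arc m n → Set
IsFlip T σ σ' =
  σ' ≢ σ × IsTriangulationP (λ τ → τ ≡ σ' ⊎ (τ ∈ T × τ ≢ σ))

IsBounding : {m n : ℕ} → List (Arc m n) → Arc m n → Set
IsBounding T σ = σ ∈ T × IsPeripheral σ × ∃ λ σ' → IsFlip T σ σ' × IsBridging σ'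

-- a marked point strictly inside (the polygon cut off by) a peripheral arc
StrictlyInsideOuter : {m n : ℕ} → Fin m → Arc m n → Set
StrictlyInsideOuter {m} p (outer a d _ _) =
  Σ ℕ λ t → Σ ℕ λ q → (1 ℕ.≤ t) × (t ℕ.< d) × (toℕ a ℕ.+ t ≡ toℕ p ℕ.+ q ℕ.* m)
StrictlyInsideOuter p (inner _ _ _ _) = ⊥
StrictlyInsideOuter p (bridge _ _) = ⊥

StrictlyInsideInner : {m n : ℕ} → Fin n → Arc m n → Set
StrictlyInsideInner {m} {n} p (inner b d _ _) =
  Σ ℕ λ t → Σ ℕ λ q → (1 ℕ.≤ t) × (t ℕ.< d) × (toℕ b ℕ.+ t ≡ toℕ p ℕ.+ q ℕ.* n)
StrictlyInsideInner p (outer _ _ _ _) = ⊥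
StrictlyInsideInner p (bridge _ _) = ⊥

-- marked points removed when cutting off the polygons at bounding arcs
RemovedOuter : {m n : ℕ} → List (Arc m n) → Fin m → Set
RemovedOuter T p = ∃ λ σ → IsBounding T σ × StrictlyInsideOuter p σ

RemovedInner : {m n : ℕ} → List (Arc m n) → Fin n → Set
RemovedInner T p = ∃ λ σ → IsBounding T σ × StrictlyInsideInner p σ

IsRemainingOuter : {m n : ℕ} → List (Arc m n) → Subset m → Set
IsRemainingOuter {m} T R = ∀ (p : Fin m) → (p Sub.∈ R → ¬ RemovedOuter T p) × (¬ RemovedOuter T p → p Sub.∈ R)

IsRemainingInner : {m n : ℕ} → List (Arc m n) → Subset n → Set
IsRemainingInner {m} {n} T R = ∀ (p : Fin n) → (p Sub.∈ R → ¬ RemovedInner T p) × (¬ RemovedInner T p → p Sub.∈ R)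

rank : {m : ℕ} → Subset m → ℕ → ℕ
rank [] _ = 0
rank (_ ∷ _) zero = 0
rank (true ∷ R) (suc r) = suc (rank R r)
rank (false ∷ R) (suc r) = rank R r

-- order-preserving, deck-equivariant relabelling of lifted surviving
-- points: position i (lift on a line with n points) ↦ its index among
-- the lifts of surviving points (a line with ∣ R ∣ points)
relabel : (n : ℕ) .{{_ : NonZero n}} → Subset n → ℤ → ℤ
relabel n R i = (i /ℕ n) ℤ.* + Sub.∣ R ∣ ℤ.+ + rank R (i %ℕ n)

LiftOf : {m' n' : ℕ} → Arc m' n' → ℤ → ℤ → Set
LiftOf {m'} {n'} (bridge a j) I J =
  ∃ λ (k : ℤ) → (+ toℕ a ℤ.+ k ℤ.* + m' ≡ I) × (j ℤ.+ k ℤ.* + n' ≡ J)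
LiftOf (outer _ _ _ _) I J = ⊥
LiftOf (inner _ _ _ _) I J = ⊥

-- the skeletal triangulation T^s, as a collection of arcs of
-- C_{∣Ro∣,∣Ri∣}: after cutting along all bounding arcs and removing the
-- polygons, all peripheral arcs are gone (bounding arcs become boundary
-- segments) and the bridging arcs of T survive, with their endpoints
-- relabelled among the surviving marked points.
Skeletal : {m n : ℕ} .{{_ : NonZero m}} .{{_ : NonZero n}} →
           List (Arc m n) → (Ro : Subset m) (Ri : Subset n) →
           Arc (Sub.∣ Ro ∣) (Sub.∣ Ri ∣) → Set
Skeletal {m} {n} T Ro Ri β =
  ∃ λ (a : Fin m) → ∃ λ (j : ℤ) →
    (bridge a j ∈ T) × LiftOf β (relabel m Ro (+ toℕ a)) (relabel n Ri j)

module Submission where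

-- Work in the universal cover of the annulus, where marked points are integers on
-- two lines and arcs of T lift to chords. Call a marked point free if no
-- peripheral arc of T passes over it. Every peripheral arc of T has an apex, the
-- third vertex of the triangle of T below it; distinct arcs have distinct apexes,
-- and the non-free points are exactly the apexes. So each side has m − k₁
-- (resp. n − k₂) free points, and at least one: the left end of a widest
-- peripheral arc. A point is removed iff it is not free, because every peripheral
-- arc of T lies below a maximal one and maximal peripheral arcs are bounding.
-- Relabelling the free points by rank preserves their order, so the bridging arcs
-- of T stay pairwise non-crossing in the smaller annulus; they are maximal there
-- since every free point carries a bridging arc of T, which rules out peripheral
-- arcs, and a bridging arc compatible with all of them lifts to one compatible
-- with T.

open import Defs
open import Data.Nat as ℕ using (ℕ; zero; suc; NonZero; z≤n; s≤s)
import Data.Nat.Properties as ℕP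
open import Data.Integer as ℤ using (ℤ; +_; +<+; +≤+)
import Data.Integer.Properties as ℤP
open import Data.Integer.DivMod using (_/ℕ_; _%ℕ_; n%ℕd<d; a≡a%ℕn+[a/ℕn]*n)
open import Data.Integer.Tactic.RingSolver using (solve-∀)
open import Algebra.Properties.CommutativeSemigroup ℤP.+-commutativeSemigroup using () renaming (xy∙z≈xz∙y to +-rightComm)
open import Algebra.Properties.AbelianGroup ℤP.+-0-abelianGroup using (∙-cancelˡ; ∙-cancelʳ)
open import Data.Fin as F using (Fin; toℕ)
import Data.Fin.Properties as FP
open import Data.Fin.Subset as Sub using (Subset)
import Data.Fin.Subset.Properties as SubP
open import Data.Bool using (true; false)
open import Data.Vec as V using ([]; _∷_)
open import Data.Product using (Σ; ∃; _×_; _,_; proj₁; proj₂)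
open import Data.Sum using (_⊎_; inj₁; inj₂)
open import Data.Empty using (⊥; ⊥-elim)
open import Data.Unit using (⊤; tt)
open import Relation.Nullary using (¬_; Dec; yes; no)
open import Relation.Nullary.Decidable using (recompute)
open import Data.List using (List) renaming ([] to []L; _∷_ to _∷L_)
open import Data.List.Membership.Propositional using (_∈_)
open import Data.List.Relation.Unary.Any using (here; there)
open import Data.List.Relation.Unary.Unique.Propositional using (Unique)
open import Data.List.Relation.Unary.AllPairs using ([]; _∷_)
import Data.List.Relation.Unary.All as AllP
import Data.List.Membership.DecPropositional as DecMem
open import Relation.Binary.PropositionalEquality
open import Function using (_$_; _∘_; case_of_)
open import Relation.Binary.Definitions using (tri<; tri≈; tri>)

module IntegerLemmas where
  open import Data.Integer using (_+_; _*_; -_; _-_; _<_; _≤_)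

  x+a*p+b*p≡x+[a+b]*p : ∀ x a b p → x + a * p + b * p ≡ x + (a + b) * p
  x+a*p+b*p≡x+[a+b]*p = solve-∀

  x+0*p≡x : ∀ x p → x + + 0 * p ≡ x
  x+0*p≡x = solve-∀

  x+[0-k]*p≡x+-k*p : ∀ x k p → x + (+ 0 - k) * p ≡ x + - k * p
  x+[0-k]*p≡x+-k*p = solve-∀

  x+k*p+-k*p≡x : ∀ x k p → x + k * p + - k * p ≡ x
  x+k*p+-k*p≡x = solve-∀

  x+-k*p+k*p≡x : ∀ x k p → x + - k * p + k * p ≡ x
  x+-k*p+k*p≡x = solve-∀

  [q+k]*p+r≡q*p+r+k*p : ∀ q k p r → (q + k) * p + r ≡ q * p + r + k * p
  [q+k]*p+r≡q*p+r+k*p = solve-∀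

  i+[j-i]≡j : ∀ i j → i + (j - i) ≡ j
  i+[j-i]≡j = solve-∀

  j≡i+[j-i] : ∀ i j → j ≡ i + (j - i)
  j≡i+[j-i] = solve-∀

  i-j+j≡i : ∀ i j → i - j + j ≡ i
  i-j+j≡i = solve-∀

  i+j-j≡i : ∀ i j → i + j - j ≡ i
  i+j-j≡i = solve-∀

  x+[y+z]≡x+z+y : ∀ x y z → x + (y + z) ≡ x + z + y
  x+[y+z]≡x+z+y = solve-∀

  i+[x-i+p]≡x+p : ∀ i x p → i + (x - i + p) ≡ x + p
  i+[x-i+p]≡x+p = solve-∀

  i+[y+j+f]≡y+f+[i+j] : ∀ i y j f → i + (y + j + f) ≡ y + f + (i + j)
  i+[y+j+f]≡y+f+[i+j] = solve-∀

  +-cancelˡ-≡ : ∀ a {b c} → a + b ≡ a + c → b ≡ c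
  +-cancelˡ-≡ a {b} {c} = ∙-cancelˡ a b c

  +-cancelʳ-≡ : ∀ {a b c} → a + c ≡ b + c → a ≡ b
  +-cancelʳ-≡ {a} {b} {c} = ∙-cancelʳ c a b

  private
    j≡-i+[i+j] : ∀ i j → j ≡ - i + (i + j)
    j≡-i+[i+j] = solve-∀

  +-cancelˡ-< : ∀ a {b c} → a + b < a + c → b < c
  +-cancelˡ-< a {b} {c} h = subst₂ _<_ (sym (j≡-i+[i+j] a b)) (sym (j≡-i+[i+j] a c)) (ℤP.+-monoʳ-< (- a) h)

  +-cancelˡ-≤ : ∀ a {b c} → a + b ≤ a + c → b ≤ c
  +-cancelˡ-≤ a {b} {c} h = subst₂ _≤_ (sym (j≡-i+[i+j] a b)) (sym (j≡-i+[i+j] a c)) (ℤP.+-monoʳ-≤ (- a) h)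

  +-cancelʳ-< : ∀ {a b c} → a + c < b + c → a < b
  +-cancelʳ-< {a} {b} {c} h = +-cancelˡ-< c (subst₂ _<_ (ℤP.+-comm a c) (ℤP.+-comm b c) h)

  i<j⇒i+1≤j : ∀ {i j} → i < j → i + + 1 ≤ j
  i<j⇒i+1≤j {i} {j} h = subst (_≤ j) (ℤP.+-comm (+ 1) i) (ℤP.i<j⇒suc[i]≤j h)

  i+1≤j+1⇒i≤j : ∀ {i j} → i + + 1 ≤ j + + 1 → i ≤ j
  i+1≤j+1⇒i≤j {i} {j} h = +-cancelˡ-≤ (+ 1) (subst₂ _≤_ (ℤP.+-comm i (+ 1)) (ℤP.+-comm j (+ 1)) h)

  ¬x<y<x+1 : ∀ {x y} → x < y → y < x + + 1 → ⊥
  ¬x<y<x+1 x<y y<x+1 = ℤP.<-irrefl refl (ℤP.<-≤-trans y<x+1 (i<j⇒i+1≤j x<y))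

  +ℕ-monoʳ-< : ∀ x {t d} → t ℕ.< d → x + + t < x + + d
  +ℕ-monoʳ-< x h = ℤP.+-monoʳ-< x (+<+ h)

  +ℕ-cancelˡ-< : ∀ x {t d} → x + + t < x + + d → t ℕ.< d
  +ℕ-cancelˡ-< x h = ℤP.drop‿+<+ (+-cancelˡ-< x h)

  +ℕ-monoʳ-≤ : ∀ x {t d} → t ℕ.≤ d → x + + t ≤ x + + d
  +ℕ-monoʳ-≤ x h = ℤP.+-monoʳ-≤ x (+≤+ h)

  +ℕ-cancelˡ-≤ : ∀ x {t d} → x + + t ≤ x + + d → t ℕ.≤ d
  +ℕ-cancelˡ-≤ x h = ℤP.drop‿+≤+ (+-cancelˡ-≤ x h)

  i<i+j⇒0<j : ∀ i {j} → i < i + j → + 0 < j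
  i<i+j⇒0<j i {j} h = +-cancelˡ-< i (subst (_< i + j) (sym (ℤP.+-identityʳ i)) h)

  i+j<i⇒j<0 : ∀ i {j} → i + j < i → j < + 0
  i+j<i⇒j<0 i {j} h = +-cancelˡ-< i (subst (i + j <_) (sym (ℤP.+-identityʳ i)) h)

  0<k*M⇒0<k : ∀ k M → + 0 < k * + M → + 0 < k
  0<k*M⇒0<k k M h = ℤP.≰⇒> λ k≤0 → ℤP.<-irrefl refl (ℤP.<-≤-trans h (subst (k * + M ≤_) (ℤP.*-zeroˡ (+ M)) (ℤP.*-monoʳ-≤-nonNeg (+ M) k≤0)))

  k*M<0⇒k<0 : ∀ k M → k * + M < + 0 → k < + 0
  k*M<0⇒k<0 k M h = ℤP.≰⇒> λ 0≤k → ℤP.<-irrefl refl (ℤP.<-≤-trans h (subst (_≤ k * + M) (ℤP.*-zeroˡ (+ M)) (ℤP.*-monoʳ-≤-nonNeg (+ M) 0≤k)))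

  i<i+ℕn : ∀ x {t} → 1 ℕ.≤ t → x < x + + t
  i<i+ℕn x {t} h = subst (_< x + + t) (ℤP.+-identityʳ x) (+ℕ-monoʳ-< x h)

  i≤i+ℕn : ∀ x t → x ≤ x + + t
  i≤i+ℕn x t = ℤP.i≤i+j x (+ t)

  i+m+n≡i+[m+n] : ∀ x a b → x + + a + + b ≡ x + + (a ℕ.+ b)
  i+m+n≡i+[m+n] x a b = trans (ℤP.+-assoc x (+ a) (+ b)) (cong (λ w → x + w) (sym (ℤP.pos-+ a b)))

  i+suc[n]≡i+n+1 : ∀ x t → x + + suc t ≡ x + + t + + 1
  i+suc[n]≡i+n+1 x t = trans (cong (λ w → x + + w) (ℕP.+-comm 1 t)) (sym (i+m+n≡i+[m+n] x t 1))

  ≤⇒≡+ℕ : ∀ {x y} → x ≤ y → Σ ℕ λ e → y ≡ x + + e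
  ≤⇒≡+ℕ {x} {y} h = ℤ.∣ y - x ∣ , trans (j≡i+[j-i] x y) (cong (λ w → x + w) (sym (ℤP.0≤i⇒+∣i∣≡i (ℤP.i≤j⇒0≤j-i h))))

  pos-+-* : ∀ p q P → + (p ℕ.+ q ℕ.* P) ≡ + p + + q * + P
  pos-+-* p q P = trans (ℤP.pos-+ p (q ℕ.* P)) (cong (λ w → + p + w) (ℤP.pos-* q P))

  r+q*M<r′+q′*M : ∀ (M r r' : ℕ) (q q' : ℤ) → r ℕ.< M → q < q' → + r + q * + M < + r' + q' * + M
  r+q*M<r′+q′*M M r r' q q' r<M q<q' =
    ℤP.<-≤-trans (ℤP.+-monoˡ-< (q * + M) (+<+ r<M))
      (ℤP.≤-trans (ℤP.≤-reflexive (p+q*p≡[q+1]*p q (+ M)))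
      (ℤP.≤-trans (ℤP.*-monoʳ-≤-nonNeg (+ M) (i<j⇒i+1≤j q<q')) (ℤP.i≤j+i _ (+ r'))))
    where
    p+q*p≡[q+1]*p : ∀ q p → p + q * p ≡ (q + + 1) * p
    p+q*p≡[q+1]*p = solve-∀

  r+q*M≡r′+q′*M⇒q≡q′ : ∀ (M r r' : ℕ) (q q' : ℤ) → r ℕ.< M → r' ℕ.< M → + r + q * + M ≡ + r' + q' * + M → q ≡ q'
  r+q*M≡r′+q′*M⇒q≡q′ M r r' q q' r<M r'<M e with ℤP.<-cmp q q'
  ... | tri< lt _ _ = ⊥-elim (ℤP.<-irrefl e (r+q*M<r′+q′*M M r r' q q' r<M lt))
  ... | tri≈ _ eq _ = eq
  ... | tri> _ _ gt = ⊥-elim (ℤP.<-irrefl (sym e) (r+q*M<r′+q′*M M r' r q' q r'<M gt))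

  divMod-unique : ∀ (N : ℕ) .{{_ : NonZero N}} z r q → r ℕ.< N → z ≡ + r + q * + N → (z /ℕ N ≡ q) × (z %ℕ N ≡ r)
  divMod-unique N z r q r<N e = quot≡ , ℤP.+-injective (+-cancelʳ-≡ {c = (z /ℕ N) * + N} (trans (sym (a≡a%ℕn+[a/ℕn]*n z N)) (trans e (cong (λ w → + r + w * + N) (sym quot≡)))))
    where
    quot≡ : z /ℕ N ≡ q
    quot≡ = r+q*M≡r′+q′*M⇒q≡q′ N (z %ℕ N) r (z /ℕ N) q (n%ℕd<d z N) r<N (trans (sym (a≡a%ℕn+[a/ℕn]*n z N)) e)

  strictlyInside⇒between : ∀ (a d p P t q : ℕ) → 1 ℕ.≤ t → t ℕ.< d → a ℕ.+ t ≡ p ℕ.+ q ℕ.* P →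
                           (+ a + (- + q) * + P < + p) × (+ p < + a + + d + (- + q) * + P)
  strictlyInside⇒between a d p P t q 1≤t t<d e =
    subst (_ <_) (sym p≡) (subst (+ a + K <_) (sym (+-rightComm (+ a) (+ t) K)) (i<i+ℕn (+ a + K) 1≤t)) ,
    subst (_< + a + + d + K) (sym p≡) (ℤP.+-monoˡ-< K (+ℕ-monoʳ-< (+ a) t<d))
    where
    K : ℤ
    K = (- + q) * + P
    p≡ : + p ≡ + a + + t + K
    p≡ = sym (trans (cong (_+ K) (trans (sym (ℤP.pos-+ a t)) (trans (cong +_ e) (pos-+-* p q P))))
                    (x+k*p+-k*p≡x (+ p) (+ q) (+ P)))

  between⇒strictlyInside : ∀ (a d p P : ℕ) (k : ℤ) → p ℕ.< P → + a + k * + P < + p → + p < + a + + d + k * + P →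
                           Σ ℕ λ t → Σ ℕ λ q → (1 ℕ.≤ t) × (t ℕ.< d) × (a ℕ.+ t ≡ p ℕ.+ q ℕ.* P)
  between⇒strictlyInside a d p P k p<P h1 h2 with ≤⇒≡+ℕ (ℤP.<⇒≤ h1)
  ... | t , et = t , q , 1≤t , t<d , a+t≡p+qP
    where
    u : ℤ
    u = + a + k * + P
    1≤t : 1 ℕ.≤ t
    1≤t = ℕP.n≢0⇒n>0 (λ t≡0 → ℤP.<-irrefl (sym (trans et (trans (cong (λ w → u + + w) t≡0) (ℤP.+-identityʳ u)))) h1)
    t<d : t ℕ.< d
    t<d = +ℕ-cancelˡ-< u (subst₂ _<_ et (+-rightComm (+ a) (+ d) (k * + P)) h2)
    k≤0 : k ≤ + 0
    k≤0 = ℤP.i<j⇒i≤pred[j] {k} {+ 1} (ℤP.*-cancelʳ-<-nonNeg {k} {+ 1} (+ P)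
            (ℤP.≤-<-trans (ℤP.i≤j+i (k * + P) (+ a)) (ℤP.<-trans h1 (subst (+ p <_) (sym (ℤP.*-identityˡ (+ P))) (+<+ p<P)))))
    q : ℕ
    q = ℤ.∣ - k ∣
    a+t≡p+qP : a ℕ.+ t ≡ p ℕ.+ q ℕ.* P
    a+t≡p+qP = ℤP.+-injective (begin
      + a + + t                       ≡⟨ x+t≡x+k*p+t+-k*p (+ a) k (+ t) (+ P) ⟩
      u + + t + - k * + P             ≡⟨ cong₂ (λ w v → w + v * + P) (sym et) (sym (ℤP.0≤i⇒+∣i∣≡i (ℤP.neg-mono-≤ k≤0))) ⟩
      + p + + q * + P                 ≡⟨ sym (pos-+-* p q P) ⟩
      + (p ℕ.+ q ℕ.* P)               ∎)
      where
      open ≡-Reasoning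
      x+t≡x+k*p+t+-k*p : ∀ x k t p → x + t ≡ x + k * p + t + - k * p
      x+t≡x+k*p+t+-k*p = solve-∀

open IntegerLemmas

greatest-below : (Q : ℕ → Set) → (∀ t → Dec (Q t)) → (b u : ℕ) → Q b → b ℕ.< u →
                 Σ ℕ λ t → (b ℕ.≤ t) × (t ℕ.< u) × Q t × (∀ t' → t ℕ.< t' → t' ℕ.< u → ¬ Q t')
greatest-below Q dQ b (suc u) qb (s≤s b≤u) with dQ u
... | yes qu = u , b≤u , ℕP.≤-refl , qu , λ t' a c _ → ℕP.<-irrefl refl (ℕP.<-≤-trans a (ℕP.≤-pred c))
... | no nqu with ℕP.m≤n⇒m<n∨m≡n b≤u
...   | inj₂ refl = ⊥-elim (nqu qb)
...   | inj₁ b<u with greatest-below Q dQ b u qb b<u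
...     | t , bt , tu , qt , mxt = t , bt , ℕP.≤-trans tu (ℕP.n≤1+n u) , qt , greatest
  where greatest : ∀ t' → t ℕ.< t' → t' ℕ.< suc u → ¬ Q t'
        greatest t' a c with ℕP.m≤n⇒m<n∨m≡n (ℕP.≤-pred c)
        ... | inj₁ lt = mxt t' a lt
        ... | inj₂ refl = nqu

any-below? : (Q : ℕ → Set) → (∀ k → Dec (Q k)) → ∀ u → Dec (Σ ℕ λ k → (k ℕ.< u) × Q k)
any-below? Q dQ zero = no λ { (k , () , _) }
any-below? Q dQ (suc u) with dQ u | any-below? Q dQ u
... | yes q | _ = yes (u , ℕP.≤-refl , q)
... | no _ | yes (k , lt , q) = yes (k , ℕP.≤-trans lt (ℕP.n≤1+n u) , q)
... | no nq | no nr = no λ { (k , lt , q) → none-below k lt q }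
  where none-below : ∀ k → k ℕ.< suc u → Q k → ⊥
        none-below k lt q with ℕP.m≤n⇒m<n∨m≡n (ℕP.≤-pred lt)
        ... | inj₁ l = nr (k , l , q)
        ... | inj₂ refl = nq q

insert : ∀ {k} → Fin k → Subset k → Subset k
insert F.zero (_ ∷ S) = true ∷ S
insert (F.suc p) (b ∷ S) = b ∷ insert p S

∉⇒∣insert∣≡suc : ∀ {k} (p : Fin k) S → ¬ (p Sub.∈ S) → Sub.∣ insert p S ∣ ≡ suc Sub.∣ S ∣
∉⇒∣insert∣≡suc F.zero (true ∷ S) p∉S = ⊥-elim (p∉S V.here)
∉⇒∣insert∣≡suc F.zero (false ∷ S) p∉S = refl
∉⇒∣insert∣≡suc (F.suc p) (true ∷ S) p∉S = cong suc (∉⇒∣insert∣≡suc p S (p∉S ∘ V.there))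
∉⇒∣insert∣≡suc (F.suc p) (false ∷ S) p∉S = ∉⇒∣insert∣≡suc p S (p∉S ∘ V.there)

x∈insert[x] : ∀ {k} (p : Fin k) S → p Sub.∈ insert p S
x∈insert[x] F.zero (_ ∷ S) = V.here
x∈insert[x] (F.suc p) (_ ∷ S) = V.there (x∈insert[x] p S)

∈⇒∈insert : ∀ {k} (p q : Fin k) S → q Sub.∈ S → q Sub.∈ insert p S
∈⇒∈insert F.zero F.zero (_ ∷ S) V.here = V.here
∈⇒∈insert F.zero (F.suc q) (_ ∷ S) (V.there h) = V.there h
∈⇒∈insert (F.suc p) F.zero (_ ∷ S) V.here = V.here
∈⇒∈insert (F.suc p) (F.suc q) (_ ∷ S) (V.there h) = V.there (∈⇒∈insert p q S h)

∈insert⁻ : ∀ {k} (p q : Fin k) S → q Sub.∈ insert p S → (q ≡ p) ⊎ (q Sub.∈ S)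
∈insert⁻ F.zero F.zero (_ ∷ S) h = inj₁ refl
∈insert⁻ F.zero (F.suc q) (_ ∷ S) (V.there h) = inj₂ (V.there h)
∈insert⁻ (F.suc p) F.zero (_ ∷ S) V.here = inj₂ V.here
∈insert⁻ (F.suc p) (F.suc q) (_ ∷ S) (V.there h) with ∈insert⁻ p q S h
... | inj₁ refl = inj₁ refl
... | inj₂ h' = inj₂ (V.there h')

∈⇒rank-< : ∀ {k} (R : Subset k) (p : Fin k) r' → p Sub.∈ R → toℕ p ℕ.< r' → rank R (toℕ p) ℕ.< rank R r'
∈⇒rank-< (true ∷ R) F.zero (suc r') V.here _ = s≤s z≤n
∈⇒rank-< (true ∷ R) (F.suc p) (suc r') (V.there h) (s≤s lt) = s≤s (∈⇒rank-< R p r' h lt)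
∈⇒rank-< (false ∷ R) (F.suc p) (suc r') (V.there h) (s≤s lt) = ∈⇒rank-< R p r' h lt

rank-all≡∣R∣ : ∀ {k} (R : Subset k) → rank R k ≡ Sub.∣ R ∣
rank-all≡∣R∣ [] = refl
rank-all≡∣R∣ (true ∷ R) = cong suc (rank-all≡∣R∣ R)
rank-all≡∣R∣ (false ∷ R) = rank-all≡∣R∣ R

∈⇒rank<∣R∣ : ∀ {k} (R : Subset k) (p : Fin k) → p Sub.∈ R → rank R (toℕ p) ℕ.< Sub.∣ R ∣
∈⇒rank<∣R∣ {k} R p h = subst (rank R (toℕ p) ℕ.<_) (rank-all≡∣R∣ R) (∈⇒rank-< R p k h (FP.toℕ<n p))

rank-surjective : ∀ {k} (R : Subset k) t → t ℕ.< Sub.∣ R ∣ → Σ (Fin k) λ p → p Sub.∈ R × rank R (toℕ p) ≡ t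
rank-surjective (true ∷ R) zero lt = F.zero , V.here , refl
rank-surjective (true ∷ R) (suc t) (s≤s lt) with rank-surjective R t lt
... | p , h , e = F.suc p , V.there h , cong suc e
rank-surjective (false ∷ R) t lt with rank-surjective R t lt
... | p , h , e = F.suc p , V.there h , e

data Side : Set where
  up lo : Side

coord : Side → ℤ → ℤ → ℤ
coord up i j = i
coord lo i j = j

other : Side → Side
other up = lo
other lo = up

module Strip (m n : ℕ) where
  open import Data.Integer using (_+_; _*_; -_; _-_; _<_; _≤_)

  period : Side → ℕ
  period up = m
  period lo = n

  -- Chords of the strip: P s x y joins the points x < y on side s, B i j joins
  -- the upper point i to the lower point j.
  data Chord : Set where
    P : Side → ℤ → ℤ → Chord
    B : ℤ → ℤ → Chord

  Crosses : Chord → Chord → Set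
  Crosses (P s x y) (P s' x' y') = s ≡ s' × Interleave x y x' y'
  Crosses (P s x y) (B i j) = x < coord s i j × coord s i j < y
  Crosses (B i j) (P s x y) = x < coord s i j × coord s i j < y
  Crosses (B i j) (B i' j') = (i < i' × j' < j) ⊎ (i' < i × j < j')

  shift : ℤ → Chord → Chord
  shift k (P s x y) = P s (x + k * + period s) (y + k * + period s)
  shift k (B i j) = B (i + k * + m) (j + k * + n)

  pStart pEnd bTop bBottom : Chord → ℤ
  pStart (P _ x _) = x
  pStart (B _ _) = + 0
  pEnd (P _ _ y) = y
  pEnd (B _ _) = + 0
  bTop (B i _) = i
  bTop (P _ _ _) = + 0
  bBottom (B _ j) = j
  bBottom (P _ _ _) = + 0

  canon : Arc m n → Chord
  canon (outer a d _ _) = P up (+ toℕ a) (+ toℕ a + + d)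
  canon (inner b d _ _) = P lo (+ toℕ b) (+ toℕ b + + d)
  canon (bridge a j) = B (+ toℕ a) j

  Lift : Arc m n → Chord → Set
  Lift γ c = Σ ℤ λ k → shift k (canon γ) ≡ c

  shift-shift : ∀ k k' c → shift k (shift k' c) ≡ shift (k' + k) c
  shift-shift k k' (P s x y) = cong₂ (P s) (e x) (e y)
    where e : ∀ x → x + k' * + period s + k * + period s ≡ x + (k' + k) * + period s
          e x = x+a*p+b*p≡x+[a+b]*p x k' k (+ period s)
  shift-shift k k' (B i j) = cong₂ B (e i (+ m)) (e j (+ n))
    where e : ∀ x p → x + k' * p + k * p ≡ x + (k' + k) * p
          e x p = x+a*p+b*p≡x+[a+b]*p x k' k p

  shift-zero : ∀ c → shift (+ 0) c ≡ c
  shift-zero (P s x y) = cong₂ (P s) (x+0*p≡x x (+ period s)) (x+0*p≡x y (+ period s))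
  shift-zero (B i j) = cong₂ B (x+0*p≡x i (+ m)) (x+0*p≡x j (+ n))

  Interleave-shift : ∀ {x y x' y'} c → Interleave x y x' y' → Interleave (x + c) (y + c) (x' + c) (y' + c)
  Interleave-shift c (inj₁ (a , b , d)) = inj₁ (ℤP.+-monoˡ-< c a , ℤP.+-monoˡ-< c b , ℤP.+-monoˡ-< c d)
  Interleave-shift c (inj₂ (a , b , d)) = inj₂ (ℤP.+-monoˡ-< c a , ℤP.+-monoˡ-< c b , ℤP.+-monoˡ-< c d)

  Crosses-shift : ∀ k c c' → Crosses c c' → Crosses (shift k c) (shift k c')
  Crosses-shift k (P s x y) (P .s x' y') (refl , il) = refl , Interleave-shift _ il
  Crosses-shift k (P up x y) (B i j) (a , b) = ℤP.+-monoˡ-< _ a , ℤP.+-monoˡ-< _ b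
  Crosses-shift k (P lo x y) (B i j) (a , b) = ℤP.+-monoˡ-< _ a , ℤP.+-monoˡ-< _ b
  Crosses-shift k (B i j) (P up x y) (a , b) = ℤP.+-monoˡ-< _ a , ℤP.+-monoˡ-< _ b
  Crosses-shift k (B i j) (P lo x y) (a , b) = ℤP.+-monoˡ-< _ a , ℤP.+-monoˡ-< _ b
  Crosses-shift k (B i j) (B i' j') (inj₁ (a , b)) = inj₁ (ℤP.+-monoˡ-< _ a , ℤP.+-monoˡ-< _ b)
  Crosses-shift k (B i j) (B i' j') (inj₂ (a , b)) = inj₂ (ℤP.+-monoˡ-< _ a , ℤP.+-monoˡ-< _ b)

  Interleave-sym : ∀ {x y x' y'} → Interleave x y x' y' → Interleave x' y' x y
  Interleave-sym (inj₁ h) = inj₂ h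
  Interleave-sym (inj₂ h) = inj₁ h

  Crosses-sym : ∀ c c' → Crosses c c' → Crosses c' c
  Crosses-sym (P s x y) (P .s x' y') (refl , il) = refl , Interleave-sym il
  Crosses-sym (P s x y) (B i j) h = h
  Crosses-sym (B i j) (P s x y) h = h
  Crosses-sym (B i j) (B i' j') (inj₁ (a , b)) = inj₂ (a , b)
  Crosses-sym (B i j) (B i' j') (inj₂ (a , b)) = inj₁ (a , b)

  shift-inverse : ∀ k c → shift (- k) (shift k c) ≡ c
  shift-inverse k c = trans (shift-shift (- k) k c) (trans (cong (λ z → shift z c) (ℤP.+-inverseʳ k)) (shift-zero c))

  Crosses-normaliseʳ : ∀ k1 k2 c c' → Crosses (shift k1 c) (shift k2 c') → Crosses c (shift (k2 - k1) c')
  Crosses-normaliseʳ k1 k2 c c' h = subst₂ Crosses (shift-inverse k1 c) (shift-shift (- k1) k2 c') (Crosses-shift (- k1) _ _ h)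

  Crosses-normaliseˡ : ∀ k1 k2 c c' → Crosses (shift k1 c) (shift k2 c') → Crosses (shift (k1 - k2) c) c'
  Crosses-normaliseˡ k1 k2 c c' h = subst₂ Crosses (shift-shift (- k2) k1 c) (shift-inverse k2 c') (Crosses-shift (- k2) _ _ h)

  Crosses-canon⇒Cross : ∀ γ τ k → Crosses (canon γ) (shift k (canon τ)) → Cross γ τ
  Crosses-canon⇒Cross (outer a d _ _) (outer a' d' _ _) k (_ , il) = k , subst (Interleave _ _ _) (+-rightComm (+ toℕ a') (+ d') (k * + m)) il
  Crosses-canon⇒Cross (outer a d _ _) (inner b d' _ _) k (() , _)
  Crosses-canon⇒Cross (outer a d _ _) (bridge a' j) k h = k , h
  Crosses-canon⇒Cross (inner b d _ _) (outer a d' _ _) k (() , _)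
  Crosses-canon⇒Cross (inner b d _ _) (inner b' d' _ _) k (_ , il) = k , subst (Interleave _ _ _) (+-rightComm (+ toℕ b') (+ d') (k * + n)) il
  Crosses-canon⇒Cross (inner b d _ _) (bridge a j) k h = k , h
  Crosses-canon⇒Cross (bridge a j) (outer a' d p q) k h =
    - k , subst (λ u → (+ toℕ a' < u) × (u < + toℕ a' + + d)) (x+[0-k]*p≡x+-k*p (+ toℕ a) k (+ m))
            (Crosses-normaliseˡ (+ 0) k (B (+ toℕ a) j) (canon (outer a' d p q))
              (subst (λ c → Crosses c (shift k (canon (outer a' d p q)))) (sym (shift-zero (B (+ toℕ a) j))) h))
  Crosses-canon⇒Cross (bridge a j) (inner b d p q) k h =
    - k , subst (λ u → (+ toℕ b < u) × (u < + toℕ b + + d)) (x+[0-k]*p≡x+-k*p j k (+ n))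
            (Crosses-normaliseˡ (+ 0) k (B (+ toℕ a) j) (canon (inner b d p q))
              (subst (λ c → Crosses c (shift k (canon (inner b d p q)))) (sym (shift-zero (B (+ toℕ a) j))) h))
  Crosses-canon⇒Cross (bridge a j) (bridge a' j') k h = k , h

  Cross⇒Crosses-canon : ∀ γ τ → Cross γ τ → Σ ℤ λ k → Crosses (canon γ) (shift k (canon τ))
  Cross⇒Crosses-canon (outer a d _ _) (outer a' d' _ _) (k , il) = k , refl , subst (Interleave _ _ _) (sym (+-rightComm (+ toℕ a') (+ d') (k * + m))) il
  Cross⇒Crosses-canon (outer a d _ _) (inner b d' _ _) ()
  Cross⇒Crosses-canon (outer a d _ _) (bridge a' j) (k , h) = k , h
  Cross⇒Crosses-canon (inner b d _ _) (outer a d' _ _) ()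
  Cross⇒Crosses-canon (inner b d _ _) (inner b' d' _ _) (k , il) = k , refl , subst (Interleave _ _ _) (sym (+-rightComm (+ toℕ b') (+ d') (k * + n))) il
  Cross⇒Crosses-canon (inner b d _ _) (bridge a j) (k , h) = k , h
  Cross⇒Crosses-canon (bridge a j) τ@(outer a' d _ _) (k , h) =
    (+ 0 - k) , Crosses-normaliseʳ k (+ 0) (canon (bridge a j)) (canon τ) (subst (Crosses (shift k (canon (bridge a j)))) (sym (shift-zero (canon τ))) h)
  Cross⇒Crosses-canon (bridge a j) τ@(inner b d _ _) (k , h) =
    (+ 0 - k) , Crosses-normaliseʳ k (+ 0) (canon (bridge a j)) (canon τ) (subst (Crosses (shift k (canon (bridge a j)))) (sym (shift-zero (canon τ))) h)
  Cross⇒Crosses-canon (bridge a j) (bridge a' j') (k , h) = k , h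

  Lift-canon : ∀ γ → Lift γ (canon γ)
  Lift-canon γ = + 0 , shift-zero (canon γ)

  Lift-shift : ∀ {γ c} k → Lift γ c → Lift γ (shift k c)
  Lift-shift {γ} k (k1 , refl) = (k1 + k) , sym (shift-shift k k1 (canon γ))

  Crosses⇒Cross : ∀ {γ τ g t} → Lift γ g → Lift τ t → Crosses g t → Cross γ τ
  Crosses⇒Cross {γ} {τ} (k1 , refl) (k2 , refl) h = Crosses-canon⇒Cross γ τ (k2 - k1) (Crosses-normaliseʳ k1 k2 _ _ h)

  Cross⇒Crosses : ∀ {γ τ} → Cross γ τ → Σ Chord λ t → Lift τ t × Crosses (canon γ) t
  Cross⇒Crosses {γ} {τ} cr with Cross⇒Crosses-canon γ τ cr
  ... | k , h = shift k (canon τ) , (k , refl) , h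

  Lift-related : ∀ {γ c c'} → Lift γ c → Lift γ c' → Σ ℤ λ k → shift k c ≡ c'
  Lift-related {γ} (k1 , refl) (k2 , refl) = (k2 - k1) , trans (shift-shift (k2 - k1) k1 (canon γ)) (cong (λ z → shift z (canon γ)) (i+[j-i]≡j k1 k2))

  Cross⇒Crosses-lifts : ∀ {γ τ g t} → Lift γ g → Lift τ t → Cross γ τ → Σ ℤ λ k → Crosses g (shift k t)
  Cross⇒Crosses-lifts {γ} {τ} {g} {t} (k1 , refl) lt cr with Cross⇒Crosses {γ} {τ} cr
  ... | t0 , lt0 , h with Lift-related lt lt0
  ...   | k2 , refl = (k2 + k1) , subst (Crosses g) (shift-shift k1 k2 t) (Crosses-shift k1 _ _ h)

module LiftedArcs (m n : ℕ) {{nzm : NonZero m}} {{nzn : NonZero n}} where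
  open import Data.Integer using (_+_; _*_; -_; _-_; _<_; _≤_)
  open Strip m n

  arcOfP : (s : Side) (x : ℤ) (d : ℕ) → .(2 ℕ.≤ d) → .(d ℕ.≤ period s) → Arc m n
  arcOfP up x d p q = outer (F.fromℕ< (n%ℕd<d x m)) d p q
  arcOfP lo x d p q = inner (F.fromℕ< (n%ℕd<d x n)) d p q

  arcOfB : ℤ → ℤ → Arc m n
  arcOfB i j = bridge (F.fromℕ< (n%ℕd<d i m)) (j - (i /ℕ m) * + n)

  private
    rem+quot*M≡x : ∀ (M : ℕ) .{{_ : NonZero M}} (x : ℤ) (d : ℤ) →
          (+ (x %ℕ M) + (x /ℕ M) * + M ≡ x) × (+ (x %ℕ M) + d + (x /ℕ M) * + M ≡ x + d)
    rem+quot*M≡x M x d = sym (a≡a%ℕn+[a/ℕn]*n x M) ,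
                trans (+-rightComm (+ (x %ℕ M)) d ((x /ℕ M) * + M)) (cong (_+ d) (sym (a≡a%ℕn+[a/ℕn]*n x M)))

  Lift-arcOfP : ∀ s x d .(p : 2 ℕ.≤ d) .(q : d ℕ.≤ period s) → Lift (arcOfP s x d p q) (P s x (x + + d))
  Lift-arcOfP up x d p q rewrite FP.toℕ-fromℕ< (n%ℕd<d x m) =
    (x /ℕ m) , cong₂ (P up) (proj₁ (rem+quot*M≡x m x (+ d))) (proj₂ (rem+quot*M≡x m x (+ d)))
  Lift-arcOfP lo x d p q rewrite FP.toℕ-fromℕ< (n%ℕd<d x n) =
    (x /ℕ n) , cong₂ (P lo) (proj₁ (rem+quot*M≡x n x (+ d))) (proj₂ (rem+quot*M≡x n x (+ d)))

  Lift-arcOfB : ∀ i j → Lift (arcOfB i j) (B i j)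
  Lift-arcOfB i j rewrite FP.toℕ-fromℕ< (n%ℕd<d i m) =
    (i /ℕ m) , cong₂ B (proj₁ (rem+quot*M≡x m i (+ 0))) (i-j+j≡i j ((i /ℕ m) * + n))

  canon-injective : ∀ γ γ' k → canon γ ≡ shift k (canon γ') → γ ≡ γ'
  canon-injective (outer a d _ _) (outer a' d' _ _) k e with cong pStart e | cong pEnd e
  ... | e1 | e2 with r+q*M≡r′+q′*M⇒q≡q′ m (toℕ a) (toℕ a') (+ 0) k (FP.toℕ<n a) (FP.toℕ<n a') (trans (x+0*p≡x (+ toℕ a) (+ m)) e1)
  ... | refl with FP.toℕ-injective (ℤP.+-injective (trans e1 (x+0*p≡x (+ toℕ a') (+ m))))
  ... | refl with ℤP.+-injective (+-cancelˡ-≡ (+ toℕ a) (trans e2 (x+0*p≡x (+ toℕ a + + d') (+ m))))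
  ... | refl = refl
  canon-injective (inner a d _ _) (inner a' d' _ _) k e with cong pStart e | cong pEnd e
  ... | e1 | e2 with r+q*M≡r′+q′*M⇒q≡q′ n (toℕ a) (toℕ a') (+ 0) k (FP.toℕ<n a) (FP.toℕ<n a') (trans (x+0*p≡x (+ toℕ a) (+ n)) e1)
  ... | refl with FP.toℕ-injective (ℤP.+-injective (trans e1 (x+0*p≡x (+ toℕ a') (+ n))))
  ... | refl with ℤP.+-injective (+-cancelˡ-≡ (+ toℕ a) (trans e2 (x+0*p≡x (+ toℕ a + + d') (+ n))))
  ... | refl = refl
  canon-injective (bridge a j) (bridge a' j') k e with cong bTop e | cong bBottom e
  ... | e1 | e2 with r+q*M≡r′+q′*M⇒q≡q′ m (toℕ a) (toℕ a') (+ 0) k (FP.toℕ<n a) (FP.toℕ<n a') (trans (x+0*p≡x (+ toℕ a) (+ m)) e1)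
  ... | refl with FP.toℕ-injective (ℤP.+-injective (trans e1 (x+0*p≡x (+ toℕ a') (+ m))))
  ... | refl with trans e2 (ℤP.+-identityʳ j')
  ... | refl = refl
  canon-injective (outer _ _ _ _) (inner _ _ _ _) k ()
  canon-injective (outer _ _ _ _) (bridge _ _) k ()
  canon-injective (inner _ _ _ _) (outer _ _ _ _) k ()
  canon-injective (inner _ _ _ _) (bridge _ _) k ()
  canon-injective (bridge _ _) (outer _ _ _ _) k ()
  canon-injective (bridge _ _) (inner _ _ _ _) k ()

  Lift-injective : ∀ {γ γ' c} → Lift γ c → Lift γ' c → γ ≡ γ'
  Lift-injective {γ} {γ'} (k1 , e1) (k2 , e2) =
    canon-injective γ γ' (k2 - k1) (trans (sym (shift-inverse k1 (canon γ))) (trans (cong (shift (- k1)) (trans e1 (sym e2))) (shift-shift (- k1) k2 (canon γ'))))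

  _≟-Arc_ : (γ γ' : Arc m n) → Dec (γ ≡ γ')
  outer a d _ _ ≟-Arc outer a' d' _ _ with a F.≟ a' | d ℕ.≟ d'
  ... | yes refl | yes refl = yes refl
  ... | no ne | _ = no λ { refl → ne refl }
  ... | _ | no ne = no λ { refl → ne refl }
  inner a d _ _ ≟-Arc inner a' d' _ _ with a F.≟ a' | d ℕ.≟ d'
  ... | yes refl | yes refl = yes refl
  ... | no ne | _ = no λ { refl → ne refl }
  ... | _ | no ne = no λ { refl → ne refl }
  bridge a j ≟-Arc bridge a' j' with a F.≟ a' | j ℤ.≟ j'
  ... | yes refl | yes refl = yes refl
  ... | no ne | _ = no λ { refl → ne refl }
  ... | _ | no ne = no λ { refl → ne refl }
  outer _ _ _ _ ≟-Arc inner _ _ _ _ = no λ ()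
  outer _ _ _ _ ≟-Arc bridge _ _ = no λ ()
  inner _ _ _ _ ≟-Arc outer _ _ _ _ = no λ ()
  inner _ _ _ _ ≟-Arc bridge _ _ = no λ ()
  bridge _ _ ≟-Arc outer _ _ _ _ = no λ ()
  bridge _ _ ≟-Arc inner _ _ _ _ = no λ ()

  _∈-Arc?_ : (γ : Arc m n) (L : List (Arc m n)) → Dec (γ ∈ L)
  _∈-Arc?_ = DecMem._∈?_ _≟-Arc_

  Lifted : (Arc m n → Set) → Chord → Set
  Lifted Q c = Σ (Arc m n) λ γ → Q γ × Lift γ c

  Lifted-shift : ∀ {Q c} k → Lifted Q c → Lifted Q (shift k c)
  Lifted-shift k (γ , q , l) = γ , q , Lift-shift k l

  Compatible⇒¬Crosses : ∀ {Q} → (∀ σ τ → Q σ → Q τ → Compatible σ τ) → ∀ {c c'} → Lifted Q c → Lifted Q c' → ¬ Crosses c c'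
  Compatible⇒¬Crosses H (γ , q , l) (γ' , q' , l') x = H γ γ' q q' (Crosses⇒Cross l l' x)

  ¬Crosses⇒Compatible : ∀ {Q} → (∀ {c c'} → Lifted Q c → Lifted Q c' → ¬ Crosses c c') → ∀ σ τ → Q σ → Q τ → Compatible σ τ
  ¬Crosses⇒Compatible H σ τ q q' cr with Cross⇒Crosses {σ} {τ} cr
  ... | t , l , x = H (σ , q , Lift-canon σ) (τ , q' , l) x

  ¬Crosses⇒Compatible-with : ∀ {Q γ g} → Lift γ g → (∀ {c'} → Lifted Q c' → ¬ Crosses g c') → ∀ τ → Q τ → Compatible γ τ
  ¬Crosses⇒Compatible-with {Q} {γ} (k , refl) H τ q cr with Cross⇒Crosses {γ} {τ} cr
  ... | t , l , x = H (τ , q , Lift-shift k l) (Crosses-shift k _ _ x)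

  Lift-P-span : ∀ {γ s x y} → Lift γ (P s x y) → Σ ℕ λ d → (y ≡ x + + d) × (2 ℕ.≤ d) × (d ℕ.≤ period s)
  Lift-P-span {outer a d p q} (k , refl) = d , +-rightComm (+ toℕ a) (+ d) (k * + m) , recompute (2 ℕ.≤? d) p , recompute (d ℕ.≤? m) q
  Lift-P-span {inner a d p q} (k , refl) = d , +-rightComm (+ toℕ a) (+ d) (k * + n) , recompute (2 ℕ.≤? d) p , recompute (d ℕ.≤? n) q
  Lift-P-span {bridge _ _} (k , ())

module Relabel (N : ℕ) {{_ : NonZero N}} (R : Subset N) where
  open import Data.Integer using (_+_; _*_; -_; _-_; _<_; _≤_)

  residue : ℤ → Fin N
  residue z = F.fromℕ< (n%ℕd<d z N)

  toℕ-residue : ∀ z → toℕ (residue z) ≡ z %ℕ N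
  toℕ-residue z = FP.toℕ-fromℕ< (n%ℕd<d z N)

  InR : ℤ → Set
  InR z = residue z Sub.∈ R

  relabel-shift : ∀ z k → relabel N R (z + k * + N) ≡ relabel N R z + k * + Sub.∣ R ∣
  relabel-shift z k = trans (cong₂ (λ q r → q * + Sub.∣ R ∣ + + rank R r) (proj₁ divMod) (proj₂ divMod))
                            ([q+k]*p+r≡q*p+r+k*p (z /ℕ N) k (+ Sub.∣ R ∣) (+ rank R (z %ℕ N)))
    where
    divMod : ((z + k * + N) /ℕ N ≡ z /ℕ N + k) × ((z + k * + N) %ℕ N ≡ z %ℕ N)
    divMod = divMod-unique N (z + k * + N) (z %ℕ N) (z /ℕ N + k) (n%ℕd<d z N)
               (trans (cong (λ w → w + k * + N) (a≡a%ℕn+[a/ℕn]*n z N)) (x+a*p+b*p≡x+[a+b]*p (+ (z %ℕ N)) (z /ℕ N) k (+ N)))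

  relabel-< : ∀ {z z'} → InR z → z < z' → relabel N R z < relabel N R z'
  relabel-< {z} {z'} z∈R z<z' with ℤP.<-cmp (z /ℕ N) (z' /ℕ N)
  ... | tri< q<q' _ _ = subst₂ _<_ (ℤP.+-comm (+ rank R (z %ℕ N)) (z /ℕ N * + Sub.∣ R ∣))
                                   (ℤP.+-comm (+ rank R (z' %ℕ N)) (z' /ℕ N * + Sub.∣ R ∣))
                          (r+q*M<r′+q′*M Sub.∣ R ∣ (rank R (z %ℕ N)) (rank R (z' %ℕ N)) (z /ℕ N) (z' /ℕ N) rank<∣R∣ q<q')
    where
    rank<∣R∣ : rank R (z %ℕ N) ℕ.< Sub.∣ R ∣
    rank<∣R∣ = subst (λ r → rank R r ℕ.< Sub.∣ R ∣) (toℕ-residue z) (∈⇒rank<∣R∣ R (residue z) z∈R)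
  ... | tri> _ _ q'<q = ⊥-elim (ℤP.<-asym z<z' (subst₂ _<_ (sym (a≡a%ℕn+[a/ℕn]*n z' N)) (sym (a≡a%ℕn+[a/ℕn]*n z N))
                          (r+q*M<r′+q′*M N (z' %ℕ N) (z %ℕ N) (z' /ℕ N) (z /ℕ N) (n%ℕd<d z' N) q'<q)))
  ... | tri≈ _ q≡q' _ = subst (λ q → relabel N R z < q * + Sub.∣ R ∣ + + rank R (z' %ℕ N)) q≡q'
                          (ℤP.+-monoʳ-< (z /ℕ N * + Sub.∣ R ∣) (+<+ (subst (λ r → rank R r ℕ.< rank R (z' %ℕ N)) (toℕ-residue z)
                            (∈⇒rank-< R (residue z) (z' %ℕ N) z∈R (subst (ℕ._< z' %ℕ N) (sym (toℕ-residue z)) r<r')))))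
    where
    r<r' : z %ℕ N ℕ.< z' %ℕ N
    r<r' = ℤP.drop‿+<+ (+-cancelʳ-< {c = z /ℕ N * + N} (subst₂ _<_ (a≡a%ℕn+[a/ℕn]*n z N)
             (trans (a≡a%ℕn+[a/ℕn]*n z' N) (cong (λ q → + (z' %ℕ N) + q * + N) (sym q≡q'))) z<z'))

  relabel-<⁻ : ∀ {z z'} → InR z' → relabel N R z < relabel N R z' → z < z'
  relabel-<⁻ {z} {z'} z'∈R lt with ℤP.<-cmp z z'
  ... | tri< z<z' _ _ = z<z'
  ... | tri≈ _ refl _ = ⊥-elim (ℤP.<-irrefl refl lt)
  ... | tri> _ _ z'<z = ⊥-elim (ℤP.<-asym lt (relabel-< z'∈R z'<z))

  relabel-surjective : {{_ : NonZero Sub.∣ R ∣}} → ∀ Z → Σ ℤ λ z → InR z × relabel N R z ≡ Z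
  relabel-surjective Z with rank-surjective R (Z %ℕ Sub.∣ R ∣) (n%ℕd<d Z Sub.∣ R ∣)
  ... | p , p∈R , rank≡ = z , subst (Sub._∈ R) (sym residue≡p) p∈R , relabel≡Z
    where
    z : ℤ
    z = + toℕ p + (Z /ℕ Sub.∣ R ∣) * + N
    divMod : (z /ℕ N ≡ Z /ℕ Sub.∣ R ∣) × (z %ℕ N ≡ toℕ p)
    divMod = divMod-unique N z (toℕ p) (Z /ℕ Sub.∣ R ∣) (FP.toℕ<n p) refl
    residue≡p : residue z ≡ p
    residue≡p = FP.toℕ-injective (trans (toℕ-residue z) (proj₂ divMod))
    relabel≡Z : relabel N R z ≡ Z
    relabel≡Z = trans (cong₂ (λ q r → q * + Sub.∣ R ∣ + + rank R r) (proj₁ divMod) (proj₂ divMod))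
                  (trans (cong (λ r → Z /ℕ Sub.∣ R ∣ * + Sub.∣ R ∣ + + r) rank≡)
                    (trans (ℤP.+-comm (Z /ℕ Sub.∣ R ∣ * + Sub.∣ R ∣) (+ (Z %ℕ Sub.∣ R ∣))) (sym (a≡a%ℕn+[a/ℕn]*n Z Sub.∣ R ∣))))

module Triangulated (m n : ℕ) {{nzm : NonZero m}} {{nzn : NonZero n}} (T : List (Arc m n))
             (T-compatible : ∀ σ τ → σ ∈ T → τ ∈ T → Compatible σ τ)
             (T-maximal : ∀ γ → (∀ τ → τ ∈ T → Compatible γ τ) → γ ∈ T) where
  open import Data.Integer using (_+_; _*_; -_; _-_; _<_; _≤_)
  open Strip m n
  open LiftedArcs m n

  InT : Chord → Set
  InT = Lifted (_∈ T)

  InT-noncrossing : ∀ {c c'} → InT c → InT c' → ¬ Crosses c c'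
  InT-noncrossing = Compatible⇒¬Crosses T-compatible

  InT-maximal : ∀ {γ g} → Lift γ g → (∀ {c'} → InT c' → ¬ Crosses g c') → γ ∈ T
  InT-maximal {γ} l H = T-maximal γ (¬Crosses⇒Compatible-with l H)

  InT-P : ∀ s x d → 2 ℕ.≤ d → d ℕ.≤ period s → (∀ {c'} → InT c' → ¬ Crosses (P s x (x + + d)) c') → InT (P s x (x + + d))
  InT-P s x d p q H = arcOfP s x d p q , InT-maximal (Lift-arcOfP s x d p q) H , Lift-arcOfP s x d p q

  InT-B : ∀ i j → (∀ {c'} → InT c' → ¬ Crosses (B i j) c') → InT (B i j)
  InT-B i j H = arcOfB i j , InT-maximal (Lift-arcOfB i j) H , Lift-arcOfB i j

  InT-P? : ∀ s x d → Dec (InT (P s x (x + + d)))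
  InT-P? s x d with 2 ℕ.≤? d | d ℕ.≤? period s
  ... | yes p | yes q with arcOfP s x d p q ∈-Arc? T
  ...   | yes i = yes (arcOfP s x d p q , i , Lift-arcOfP s x d p q)
  ...   | no ni = no λ { (γ , i , l) → ni (subst (_∈ T) (Lift-injective l (Lift-arcOfP s x d p q)) i) }
  InT-P? s x d | no np | _ = no λ { (γ , i , l) → np (vd l) }
    where vd : ∀ {γ} → Lift γ (P s x (x + + d)) → 2 ℕ.≤ d
          vd l with Lift-P-span l
          ... | d' , e , p , _ = subst (2 ℕ.≤_) (sym (ℤP.+-injective (+-cancelˡ-≡ x e))) p
  InT-P? s x d | _ | no nq = no λ { (γ , i , l) → nq (vd l) }
    where vd : ∀ {γ} → Lift γ (P s x (x + + d)) → d ℕ.≤ period s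
          vd l with Lift-P-span l
          ... | d' , e , _ , q = subst (ℕ._≤ period s) (sym (ℤP.+-injective (+-cancelˡ-≡ x e))) q

  Edge : Side → ℤ → ℤ → Set
  Edge s x y = (y ≡ x + + 1) ⊎ InT (P s x y)

  segment-¬Crosses : ∀ s x c' → ¬ Crosses (P s x (x + + 1)) c'
  segment-¬Crosses s x (P .s x' y') (refl , inj₁ (a , b , _)) = ¬x<y<x+1 a b
  segment-¬Crosses s x (P .s x' y') (refl , inj₂ (_ , a , b)) = ¬x<y<x+1 a b
  segment-¬Crosses s x (B i j) (a , b) = ¬x<y<x+1 a b

  Edge-noncrossing : ∀ {s x y c'} → Edge s x y → InT c' → ¬ Crosses (P s x y) c'
  Edge-noncrossing {s} {x} (inj₁ refl) _ = segment-¬Crosses s x _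
  Edge-noncrossing (inj₂ t) t' = InT-noncrossing t t'

  InT-P-span : ∀ {s x y} → InT (P s x y) → Σ ℕ λ d → (y ≡ x + + d) × (2 ℕ.≤ d) × (d ℕ.≤ period s)
  InT-P-span (γ , _ , l) = Lift-P-span l

  InT-P′ : ∀ s x y → x + + 2 ≤ y → y ≤ x + + period s → (∀ {c'} → InT c' → ¬ Crosses (P s x y) c') → InT (P s x y)
  InT-P′ s x y h1 h2 H with ≤⇒≡+ℕ (ℤP.≤-trans (i≤i+ℕn x 2) h1)
  ... | d , refl = InT-P s x d (+ℕ-cancelˡ-≤ x h1) (+ℕ-cancelˡ-≤ x h2) H

  Edge? : ∀ s x t → Dec (Edge s x (x + + t))
  Edge? s x t with (x + + t) ℤ.≟ (x + + 1) | InT-P? s x t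
  ... | yes e | _ = yes (inj₁ e)
  ... | no _ | yes tl = yes (inj₂ tl)
  ... | no ne | no nt = no λ { (inj₁ e) → ne e ; (inj₂ tl) → nt tl }

  -- The apex is the largest z joined to x by an edge; since no arc of T crosses
  -- (x, y) or separates z from y, maximality of T makes (z, y) an edge too.
  apex : ∀ {s x y} → InT (P s x y) → Σ ℤ λ z → (x < z) × (z < y) × Edge s x z × Edge s z y
  apex {s} {x} tl with InT-P-span tl
  ... | d , refl , d2 , dp with greatest-below (λ t → Edge s x (x + + t)) (Edge? s x) 1 d (inj₁ refl) d2
  ... | t , t1 , td , e1 , mxt = x + + t , i<i+ℕn x t1 , +ℕ-monoʳ-< x td , e1 , e2
    where
    z : ℤ
    z = x + + t
    H : ∀ {c'} → InT c' → ¬ Crosses (P s z (x + + d)) c'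
    H {P .s y' z'} tl' (refl , inj₁ (a , b , c)) = InT-noncrossing tl tl' (refl , inj₁ (ℤP.<-trans (i<i+ℕn x t1) a , b , c))
    H {P .s y' z'} tl' (refl , inj₂ (a , b , c)) with ℤP.<-cmp y' x
    ... | tri< lt _ _ = InT-noncrossing tl tl' (refl , inj₂ (lt , ℤP.<-trans (i<i+ℕn x t1) b , c))
    ... | tri> _ _ gt = Edge-noncrossing e1 tl' (refl , inj₁ (gt , a , b))
    ... | tri≈ _ refl _ with InT-P-span tl'
    ...   | e , refl , _ , _ = mxt e (+ℕ-cancelˡ-< x b) (+ℕ-cancelˡ-< x c) (inj₂ tl')
    H {B i j} tl' (a , b) = InT-noncrossing tl tl' (ℤP.<-trans (i<i+ℕn x t1) a , b)
    e2 : Edge s z (x + + d)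
    e2 with ℕP.m≤n⇒m<n∨m≡n td
    ... | inj₂ refl = inj₁ (i+suc[n]≡i+n+1 x t)
    ... | inj₁ st<d = inj₂ $ InT-P′ s z (x + + d) (subst (_≤ x + + d) (sym (i+m+n≡i+[m+n] x t 2)) (+ℕ-monoʳ-≤ x (subst (ℕ._≤ d) (ℕP.+-comm 2 t) st<d)))
              (subst (x + + d ≤_) (+-rightComm x (+ (period s)) (+ t)) (ℤP.≤-trans (+ℕ-monoʳ-≤ x dp) (i≤i+ℕn (x + + period s) t))) H

  Edge⇒InT : ∀ {s x y w} → Edge s x y → x < w → w < y → InT (P s x y)
  Edge⇒InT (inj₁ refl) a b = ⊥-elim (¬x<y<x+1 a b)
  Edge⇒InT (inj₂ t) _ _ = t

  IsApex : Side → ℤ → ℤ → ℤ → Set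
  IsApex s x y z = InT (P s x y) × (x < z) × (z < y) × Edge s x z × Edge s z y

  apex-unique : ∀ {s x y z z'} → IsApex s x y z → IsApex s x y z' → z ≡ z'
  apex-unique {s} {x} {y} {z} {z'} (tl , a , b , e1 , e2) (_ , a' , b' , e1' , e2') with ℤP.<-cmp z z'
  ... | tri≈ _ eq _ = eq
  ... | tri< lt _ _ = ⊥-elim (InT-noncrossing (Edge⇒InT e2 lt b') (Edge⇒InT e1' a lt) (refl , inj₂ (a , lt , b')))
  ... | tri> _ _ gt = ⊥-elim (InT-noncrossing (Edge⇒InT e2' gt b) (Edge⇒InT e1 a' gt) (refl , inj₂ (a' , gt , b)))

  apex-innermost : ∀ {s x y z x' y'} → IsApex s x y z → InT (P s x' y') → x' < z → z < y' → (x' ≤ x) × (y ≤ y')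
  apex-innermost {s} {x} {y} {z} {x'} {y'} (tl , a , b , e1 , e2) tl' a' b' = l1 , l2
    where
    l1 : x' ≤ x
    l1 with ℤP.<-cmp x x'
    ... | tri< lt _ _ = ⊥-elim (InT-noncrossing (Edge⇒InT e1 lt a') tl' (refl , inj₁ (lt , a' , b')))
    ... | tri≈ _ refl _ = ℤP.≤-refl
    ... | tri> _ _ gt = ℤP.<⇒≤ gt
    l2 : y ≤ y'
    l2 with ℤP.<-cmp y' y
    ... | tri< lt _ _ = ⊥-elim (InT-noncrossing (Edge⇒InT e2 b' lt) tl' (refl , inj₂ (a' , b' , lt)))
    ... | tri≈ _ refl _ = ℤP.≤-refl
    ... | tri> _ _ gt = ℤP.<⇒≤ gt

  apex-determines-chord : ∀ {s x y x' y' z} → IsApex s x y z → IsApex s x' y' z → (x ≡ x') × (y ≡ y')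
  apex-determines-chord ap@(tl , a , b , _) ap'@(tl' , a' , b' , _) with apex-innermost ap tl' a' b' | apex-innermost ap' tl a b
  ... | l1 , l2 | l1' , l2' = ℤP.≤-antisym l1' l1 , ℤP.≤-antisym l2 l2'

  -- Descend through the triangles below (x, y) until p is the apex; f bounds the width.
  descend-to-apex : ∀ {s} f x y p → InT (P s x y) → y ≤ x + + f → x < p → p < y → Σ ℤ λ x' → Σ ℤ λ y' → IsApex s x' y' p
  descend-to-apex zero x y p tl le a b = ⊥-elim (ℤP.<-irrefl refl (ℤP.<-≤-trans (ℤP.<-trans a b) (subst (y ≤_) (ℤP.+-identityʳ x) le)))
  descend-to-apex {s} (suc f) x y p tl le a b with apex tl
  ... | z , xz , zy , e1 , e2 with ℤP.<-cmp z p
  ...   | tri≈ _ refl _ = x , y , tl , xz , zy , e1 , e2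
  ...   | tri< lt _ _ = descend-to-apex f z y p (Edge⇒InT e2 lt b) le' lt b
    where le' : y ≤ z + + f
          le' = ℤP.≤-trans le (subst (_≤ z + + f) (sym (i+suc[n]≡i+n+1 x f))
                   (subst (_≤ z + + f) (+-rightComm x (+ 1) (+ f)) (ℤP.+-monoˡ-≤ (+ f) (i<j⇒i+1≤j xz))))
  ...   | tri> _ _ gt = descend-to-apex f x z p (Edge⇒InT e1 a gt) le'' a gt
    where le'' : z ≤ x + + f
          le'' = i+1≤j+1⇒i≤j (ℤP.≤-trans (i<j⇒i+1≤j zy) (subst (y ≤_) (i+suc[n]≡i+n+1 x f) le))

  bridgeFrom : Side → ℤ → ℤ → Chord
  bridgeFrom up z w = B z w
  bridgeFrom lo z w = B w z

  bridgeFrom-coord : ∀ s i j → bridgeFrom s (coord s i j) (coord (other s) i j) ≡ B i j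
  bridgeFrom-coord up i j = refl
  bridgeFrom-coord lo i j = refl

  P-Crosses-bridgeFrom : ∀ s {x y z w} → x < z → z < y → Crosses (P s x y) (bridgeFrom s z w)
  P-Crosses-bridgeFrom up a b = a , b
  P-Crosses-bridgeFrom lo a b = a , b

  P-other-Crosses-bridgeFrom : ∀ s {x y z w} → x < w → w < y → Crosses (P (other s) x y) (bridgeFrom s z w)
  P-other-Crosses-bridgeFrom up a b = a , b
  P-other-Crosses-bridgeFrom lo a b = a , b

  bridgeFrom-Crosses : ∀ s {z w z' w'} → (z < z' × w' < w) ⊎ (z' < z × w < w') → Crosses (bridgeFrom s z w) (bridgeFrom s z' w')
  bridgeFrom-Crosses up h = h
  bridgeFrom-Crosses lo (inj₁ (a , b)) = inj₂ (b , a)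
  bridgeFrom-Crosses lo (inj₂ (a , b)) = inj₁ (b , a)

  bridgeFrom-Crosses⁻ : ∀ s {z w z' w'} → Crosses (bridgeFrom s z w) (bridgeFrom s z' w') → (z < z' × w' < w) ⊎ (z' < z × w < w')
  bridgeFrom-Crosses⁻ up h = h
  bridgeFrom-Crosses⁻ lo (inj₁ (a , b)) = inj₂ (b , a)
  bridgeFrom-Crosses⁻ lo (inj₂ (a , b)) = inj₁ (b , a)

  Free : Side → ℤ → Set
  Free s z = ∀ {x y} → InT (P s x y) → ¬ ((x < z) × (z < y))

  quot : Side → ℤ → ℤ
  quot up x = x /ℕ m
  quot lo x = x /ℕ n

  rem : Side → ℤ → ℕ
  rem up x = x %ℕ m
  rem lo x = x %ℕ n

  quot-rem : ∀ s x → x ≡ + rem s x + quot s x * + period s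
  quot-rem up x = a≡a%ℕn+[a/ℕn]*n x m
  quot-rem lo x = a≡a%ℕn+[a/ℕn]*n x n

  rem<period : ∀ s x → rem s x ℕ.< period s
  rem<period up x = n%ℕd<d x m
  rem<period lo x = n%ℕd<d x n

  IsBridging? : (γ : Arc m n) → Dec (IsBridging γ)
  IsBridging? (bridge _ _) = yes tt
  IsBridging? (outer _ _ _ _) = no λ ()
  IsBridging? (inner _ _ _ _) = no λ ()

  -- The endpoint opposite to z of the last lift of a bridging arc whose side-s
  -- endpoint is at most z.
  reach : Side → ℤ → Arc m n → ℤ
  reach s z (bridge a j0) = coord (other s) (+ toℕ a) j0 + quot s (z - coord s (+ toℕ a) j0) * + period (other s)
  reach s z _ = + 0

  HighestBridge : Side → ℤ → List (Arc m n) → Set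
  HighestBridge s z L = Σ ℤ λ w → Σ (Arc m n) λ γ* → γ* ∈ L × IsBridging γ* × reach s z γ* ≡ w × (∀ γ → γ ∈ L → IsBridging γ → reach s z γ ≤ w)

  highestBridge? : ∀ s z (L : List (Arc m n)) → (∀ γ → γ ∈ L → ¬ IsBridging γ) ⊎ HighestBridge s z L
  highestBridge? s z []L = inj₁ λ γ ()
  highestBridge? s z (γ ∷L L) with IsBridging? γ | highestBridge? s z L
  ... | no nb | inj₁ none = inj₁ λ { γ' (here refl) → nb ; γ' (there i) → none γ' i }
  ... | no nb | inj₂ (w , g , gi , gb , ge , gmx) = inj₂ (w , g , there gi , gb , ge , λ { γ' (here refl) b → ⊥-elim (nb b) ; γ' (there i) b → gmx γ' i b })
  ... | yes b | inj₁ none = inj₂ (reach s z γ , γ , here refl , b , refl , λ { γ' (here refl) _ → ℤP.≤-refl ; γ' (there i) b' → ⊥-elim (none γ' i b') })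
  ... | yes b | inj₂ (w , g , gi , gb , ge , gmx) with ℤP.≤-total (reach s z γ) w
  ...   | inj₁ le = inj₂ (w , g , there gi , gb , ge , λ { γ' (here refl) _ → le ; γ' (there i) b' → gmx γ' i b' })
  ...   | inj₂ ge' = inj₂ (reach s z γ , γ , here refl , b , refl , λ { γ' (here refl) _ → ℤP.≤-refl ; γ' (there i) b' → ℤP.≤-trans (gmx γ' i b') ge' })

  Lift-B-view : ∀ s {γ i j} → Lift γ (B i j) → Σ (Fin m) λ a → Σ ℤ λ j0 → Σ ℤ λ k → (γ ≡ bridge a j0) ×
            (coord s i j ≡ coord s (+ toℕ a) j0 + k * + period s) × (coord (other s) i j ≡ coord (other s) (+ toℕ a) j0 + k * + period (other s))
  Lift-B-view up {bridge a j0} (k , refl) = a , j0 , k , refl , refl , refl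
  Lift-B-view lo {bridge a j0} (k , refl) = a , j0 , k , refl , refl , refl
  Lift-B-view up {outer _ _ _ _} (k , ())
  Lift-B-view up {inner _ _ _ _} (k , ())
  Lift-B-view lo {outer _ _ _ _} (k , ())
  Lift-B-view lo {inner _ _ _ _} (k , ())

  InT-bridgeFrom-shift : ∀ s a j0 k → InT (shift k (canon (bridge a j0))) → InT (bridgeFrom s (coord s (+ toℕ a) j0 + k * + period s) (coord (other s) (+ toℕ a) j0 + k * + period (other s)))
  InT-bridgeFrom-shift up a j0 k t = t
  InT-bridgeFrom-shift lo a j0 k t = t

  bridgeFrom-P-view : ∀ s s' {z w x y} → Crosses (bridgeFrom s z w) (P s' x y) → ((s' ≡ s) × (x < z) × (z < y)) ⊎ ((s' ≡ other s) × (x < w) × (w < y))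
  bridgeFrom-P-view up up (a , b) = inj₁ (refl , a , b)
  bridgeFrom-P-view up lo (a , b) = inj₂ (refl , a , b)
  bridgeFrom-P-view lo up (a , b) = inj₂ (refl , a , b)
  bridgeFrom-P-view lo lo (a , b) = inj₁ (refl , a , b)

  InT-bridgeFrom : ∀ s z w → (∀ {c'} → InT c' → ¬ Crosses (bridgeFrom s z w) c') → InT (bridgeFrom s z w)
  InT-bridgeFrom up z w H = InT-B z w H
  InT-bridgeFrom lo z w H = InT-B w z H

  bridgeFrom-B-view : ∀ s {z w i j} → Crosses (bridgeFrom s z w) (B i j) → (z < coord s i j × coord (other s) i j < w) ⊎ (coord s i j < z × w < coord (other s) i j)
  bridgeFrom-B-view s {z} {w} {i} {j} h = bridgeFrom-Crosses⁻ s (subst (Crosses (bridgeFrom s z w)) (sym (bridgeFrom-coord s i j)) h)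

  shift≤quot : ∀ s z u0 k → u0 + k * + period s ≤ z → k ≤ quot s (z - u0)
  shift≤quot s z u0 k le = ℤP.≮⇒≥ λ lt → ℤP.<-irrefl refl (ℤP.<-≤-trans (contra lt) le)
    where contra : quot s (z - u0) < k → z < u0 + k * + period s
          contra lt = subst₂ _<_ (sym (trans (j≡i+[j-i] u0 z) (cong (λ v → u0 + v) (quot-rem s (z - u0))))) (cong (λ v → u0 + v) (ℤP.+-identityˡ (k * + period s)))
                        (ℤP.+-monoʳ-< u0 (r+q*M<r′+q′*M (period s) (rem s (z - u0)) 0 (quot s (z - u0)) k (rem<period s (z - u0)) lt))

  bridge-below-highest : ∀ s z → Free s z → HighestBridge s z T →
           Σ ℤ λ w → InT (bridgeFrom s z w) × (∀ {i j} → InT (B i j) → coord s i j ≤ z → coord (other s) i j ≤ w)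
  bridge-below-highest s z fr (_ , bridge a j0 , gi , _ , refl , mxw) = w , InT-bridgeFrom s z w H , bound
    where
    u0 v0 K w us : ℤ
    u0 = coord s (+ toℕ a) j0
    v0 = coord (other s) (+ toℕ a) j0
    K = quot s (z - u0)
    w = v0 + K * + period (other s)
    us = u0 + K * + period s
    usz : us ≤ z
    usz = subst (us ≤_) (sym (trans (j≡i+[j-i] u0 z) (trans (cong (λ v → u0 + v) (quot-rem s (z - u0))) (x+[y+z]≡x+z+y u0 (+ rem s (z - u0)) (K * + period s)))))
            (ℤP.i≤i+j us (+ rem s (z - u0)))
    tls : InT (bridgeFrom s us w)
    tls = InT-bridgeFrom-shift s a j0 K (bridge a j0 , gi , K , refl)
    bound : ∀ {i j} → InT (B i j) → coord s i j ≤ z → coord (other s) i j ≤ w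
    bound (γ , γi , l) le with Lift-B-view s l
    ... | a' , j0' , k , refl , e1 , e2 =
      ℤP.≤-trans (ℤP.≤-reflexive e2)
        (ℤP.≤-trans (ℤP.+-monoʳ-≤ (coord (other s) (+ toℕ a') j0') (ℤP.*-monoʳ-≤-nonNeg (+ period (other s)) (shift≤quot s z (coord s (+ toℕ a') j0') k (subst (_≤ z) e1 le))))
          (mxw (bridge a' j0') γi tt))
    H : ∀ {c'} → InT c' → ¬ Crosses (bridgeFrom s z w) c'
    H {P s' x y} tl' h with bridgeFrom-P-view s s' h
    ... | inj₁ (refl , a1 , b1) = fr tl' (a1 , b1)
    ... | inj₂ (refl , a1 , b1) = InT-noncrossing tl' tls (P-other-Crosses-bridgeFrom s a1 b1)
    H {B i j} tl' h with bridgeFrom-B-view s h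
    ... | inj₁ (a1 , b1) = InT-noncrossing tls tl' (subst (Crosses (bridgeFrom s us w)) (bridgeFrom-coord s i j) (bridgeFrom-Crosses s (inj₁ (ℤP.≤-<-trans usz a1 , b1))))
    ... | inj₂ (a1 , b1) = ℤP.<-irrefl refl (ℤP.<-≤-trans b1 (bound tl' (ℤP.<⇒≤ a1)))

  span : Side → Arc m n → ℕ
  span up (outer _ d _ _) = d
  span lo (inner _ d _ _) = d
  span _ _ = 0

  Lift-span : ∀ {s γ x y} → Lift γ (P s x y) → y ≡ x + + span s γ
  Lift-span {up} {outer a d _ _} (k , refl) = +-rightComm (+ toℕ a) (+ d) (k * + m)
  Lift-span {lo} {inner a d _ _} (k , refl) = +-rightComm (+ toℕ a) (+ d) (k * + n)
  Lift-span {up} {inner _ _ _ _} (k , ())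
  Lift-span {up} {bridge _ _} (k , ())
  Lift-span {lo} {outer _ _ _ _} (k , ())
  Lift-span {lo} {bridge _ _} (k , ())

  canon-P : ∀ s γ → span s γ ≢ 0 → Σ ℤ λ x → canon γ ≡ P s x (x + + span s γ)
  canon-P up (outer a d _ _) _ = + toℕ a , refl
  canon-P lo (inner a d _ _) _ = + toℕ a , refl
  canon-P up (inner _ _ _ _) ne = ⊥-elim (ne refl)
  canon-P up (bridge _ _) ne = ⊥-elim (ne refl)
  canon-P lo (outer _ _ _ _) ne = ⊥-elim (ne refl)
  canon-P lo (bridge _ _) ne = ⊥-elim (ne refl)

  maxOf : (Arc m n → ℕ) → List (Arc m n) → ℕ
  maxOf f []L = 0
  maxOf f (γ ∷L L) = f γ ℕ.⊔ maxOf f L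

  maxOf-ub : ∀ f L γ → γ ∈ L → f γ ℕ.≤ maxOf f L
  maxOf-ub f (γ ∷L L) .γ (here refl) = ℕP.m≤m⊔n (f γ) (maxOf f L)
  maxOf-ub f (δ ∷L L) γ (there i) = ℕP.≤-trans (maxOf-ub f L γ i) (ℕP.m≤n⊔m (f δ) (maxOf f L))

  maxOf-attained : ∀ f L → (maxOf f L ≡ 0) ⊎ (Σ (Arc m n) λ γ → γ ∈ L × f γ ≡ maxOf f L)
  maxOf-attained f []L = inj₁ refl
  maxOf-attained f (γ ∷L L) with ℕP.⊔-sel (f γ) (maxOf f L)
  ... | inj₁ e = inj₂ (γ , here refl , sym e)
  ... | inj₂ e with maxOf-attained f L
  ...   | inj₁ z = inj₁ (trans e z)
  ...   | inj₂ (δ , i , e') = inj₂ (δ , there i , trans e' (sym e))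

  maxSpan≡0⇒¬InT-P : ∀ {s x y} → maxOf (span s) T ≡ 0 → ¬ InT (P s x y)
  maxSpan≡0⇒¬InT-P {s} {x} max≡0 (γ , γi , l) with Lift-P-span l
  ... | d , e , 2≤d , _ = ℕP.<-irrefl refl (ℕP.<-≤-trans (ℕP.<-≤-trans (s≤s z≤n) 2≤d)
        (ℕP.≤-trans (ℕP.≤-reflexive (ℤP.+-injective (+-cancelˡ-≡ x (trans (sym e) (Lift-span l)))))
                    (subst (span s γ ℕ.≤_) max≡0 (maxOf-ub (span s) T γ γi))))

  -- The left endpoint of a widest peripheral arc of T on side s is free.
  free-exists : ∀ s → Σ ℤ (Free s)
  free-exists s with maxOf-attained (span s) T
  ... | inj₁ max≡0 = + 0 , λ tl _ → maxSpan≡0⇒¬InT-P max≡0 tl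
  ... | inj₂ (γ , γi , e) with span s γ ℕ.≟ 0
  ...   | yes span≡0 = + 0 , λ tl _ → maxSpan≡0⇒¬InT-P (trans (sym e) span≡0) tl
  ...   | no span≢0 with canon-P s γ span≢0
  ...     | x0 , ec = x0 , free
    where
    M : ℕ
    M = span s γ
    widest : InT (P s x0 (x0 + + M))
    widest = γ , γi , subst (Lift γ) ec (Lift-canon γ)
    width≤M : ∀ {x y} → InT (P s x y) → y ≤ x + + M
    width≤M {x} (γ' , γi' , l') =
      subst (_≤ x + + M) (sym (Lift-span l')) (+ℕ-monoʳ-≤ x (subst (span s γ' ℕ.≤_) (sym e) (maxOf-ub (span s) T γ' γi')))
    free : Free s x0
    free {x} {y} tl (x<x0 , x0<y) with y ℤP.<? x0 + + M
    ... | yes y<x0+M = InT-noncrossing widest tl (refl , inj₂ (x<x0 , x0<y , y<x0+M))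
    ... | no y≮x0+M = ℤP.<-irrefl refl (ℤP.<-≤-trans (ℤP.+-monoˡ-< (+ M) x<x0) (ℤP.≤-trans (ℤP.≮⇒≥ y≮x0+M) (width≤M tl)))

  Lift-B⇒IsBridging : ∀ {γ i j} → Lift γ (B i j) → IsBridging γ
  Lift-B⇒IsBridging l with Lift-B-view up l
  ... | a , j0 , k , refl , _ = tt

  highestBridge : ∀ s z → HighestBridge s z T
  highestBridge s z with highestBridge? s z T
  ... | inj₂ b = b
  ... | inj₁ none with free-exists up | free-exists lo
  ...   | z1 , f1 | z2 , f2 with InT-B z1 z2 H
    where
    H : ∀ {c'} → InT c' → ¬ Crosses (B z1 z2) c'
    H {P up x y} tl h = f1 tl h
    H {P lo x y} tl h = f2 tl h
    H {B i j} (γ , γi , l) _ = none γ γi (Lift-B⇒IsBridging l)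
  ...     | (γ , γi , l) = ⊥-elim (none γ γi (Lift-B⇒IsBridging l))

  bridgeAt : ∀ s z → Free s z → Σ ℤ λ w → InT (bridgeFrom s z w) × (∀ {i j} → InT (B i j) → coord s i j ≤ z → coord (other s) i j ≤ w)
  bridgeAt s z fr = bridge-below-highest s z fr (highestBridge s z)

  Maximal : Side → ℤ → ℤ → Set
  Maximal s u v = InT (P s u v) × (∀ {x y} → InT (P s x y) → x ≤ u → v ≤ y → (x ≡ u) × (y ≡ v))

  InT-P-≤period : ∀ {s x y} → InT (P s x y) → y ≤ x + + period s
  InT-P-≤period {s} {x} tl with InT-P-span tl
  ... | d , refl , _ , dp = +ℕ-monoʳ-≤ x dp

  InT-P?′ : ∀ s x y → Dec (InT (P s x y))
  InT-P?′ s x y with x ℤP.≤? y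
  ... | yes le with ≤⇒≡+ℕ le
  ...   | d , refl = InT-P? s x d
  InT-P?′ s x y | no nle = no λ tl → nle (le tl)
    where le : InT (P s x y) → x ≤ y
          le tl with InT-P-span tl
          ... | d , refl , _ = i≤i+ℕn x d

  Enlarges : Side → ℤ → ℤ → ℕ → ℕ → Set
  Enlarges s x y i j = (1 ℕ.≤ i ℕ.+ j) × InT (P s (x - + i) (y + + j))

  Enlarges? : ∀ s x y i j → Dec (Enlarges s x y i j)
  Enlarges? s x y i j with 1 ℕ.≤? i ℕ.+ j
  ... | no ne = no λ h → ne (proj₁ h)
  ... | yes p with InT-P?′ s (x - + i) (y + + j)
  ...   | yes t = yes (p , t)
  ...   | no nt = no λ h → nt (proj₂ h)

  wide⇒Maximal : ∀ {s x y} → InT (P s x y) → x + + period s ≤ y → Maximal s x y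
  wide⇒Maximal {s} {x} {y} tl wide = tl , maximal
    where
    maximal : ∀ {x' y'} → InT (P s x' y') → x' ≤ x → y ≤ y' → (x' ≡ x) × (y' ≡ y)
    maximal {x'} {y'} tl' x'≤x y≤y' = x'≡x , ℤP.≤-antisym (ℤP.≤-trans (InT-P-≤period tl') (subst (λ w → w + + period s ≤ y) (sym x'≡x) wide)) y≤y'
      where x'≡x : x' ≡ x
            x'≡x = ℤP.≤-antisym x'≤x (+-cancelˡ-≤ (+ period s) (subst₂ _≤_ (ℤP.+-comm x (+ period s)) (ℤP.+-comm x' (+ period s))
                     (ℤP.≤-trans wide (ℤP.≤-trans y≤y' (InT-P-≤period tl')))))

  EnlargesBy≤period : Side → ℤ → ℤ → Set
  EnlargesBy≤period s x y = Σ ℕ λ i → (i ℕ.< suc (period s)) × Σ ℕ λ j → (j ℕ.< suc (period s)) × Enlarges s x y i j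

  ¬Enlarges⇒Maximal : ∀ {s x y} → InT (P s x y) → ¬ EnlargesBy≤period s x y → Maximal s x y
  ¬Enlarges⇒Maximal {s} {x} {y} tl none = tl , maximal
    where
    x≤y : x ≤ y
    x≤y with InT-P-span tl
    ... | d , refl , _ = i≤i+ℕn x d
    maximal : ∀ {x' y'} → InT (P s x' y') → x' ≤ x → y ≤ y' → (x' ≡ x) × (y' ≡ y)
    maximal {x'} {y'} tl' x'≤x y≤y' with ≤⇒≡+ℕ x'≤x | ≤⇒≡+ℕ y≤y'
    ... | i , ei | j , ej with i ℕ.+ j ℕ.≟ 0
    ...   | yes i+j≡0 = trans (sym (ℤP.+-identityʳ x')) (trans (cong (λ w → x' + + w) (sym (ℕP.m+n≡0⇒m≡0 i i+j≡0))) (sym ei)) ,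
                        trans ej (trans (cong (λ w → y + + w) (ℕP.m+n≡0⇒n≡0 i i+j≡0)) (ℤP.+-identityʳ y))
    ...   | no i+j≢0 = ⊥-elim (none (i , s≤s i≤period , j , s≤s j≤period , ℕP.n≢0⇒n>0 i+j≢0 , subst₂ (λ p q → InT (P s p q)) x'≡x-i ej tl'))
      where
      x'≡x-i : x' ≡ x - + i
      x'≡x-i = trans (sym (i+j-j≡i x' (+ i))) (cong (λ w → w - + i) (sym ei))
      i≤period : i ℕ.≤ period s
      i≤period = +ℕ-cancelˡ-≤ x' (subst (_≤ x' + + period s) ei (ℤP.≤-trans x≤y (ℤP.≤-trans y≤y' (InT-P-≤period tl'))))
      j≤period : j ℕ.≤ period s
      j≤period = +ℕ-cancelˡ-≤ y (subst (_≤ y + + period s) ej (ℤP.≤-trans (InT-P-≤period tl')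
                   (ℤP.≤-trans (ℤP.+-monoˡ-≤ (+ period s) x'≤x) (ℤP.+-monoˡ-≤ (+ period s) x≤y))))

  -- Enlarge (x, y) while some arc of T contains it; the slack f decreases, as no
  -- arc of T is wider than period s.
  maximal-above : ∀ s f x y → InT (P s x y) → x + + period s ≤ y + + f → Σ ℤ λ u → Σ ℤ λ v → Maximal s u v × (u ≤ x) × (y ≤ v)
  maximal-above s zero x y tl slack = x , y , wide⇒Maximal tl (subst (x + + period s ≤_) (ℤP.+-identityʳ y) slack) , ℤP.≤-refl , ℤP.≤-refl
  maximal-above s (suc f) x y tl slack with any-below? (λ i → Σ ℕ λ j → (j ℕ.< suc (period s)) × Enlarges s x y i j)
                                      (λ i → any-below? (Enlarges s x y i) (Enlarges? s x y i) (suc (period s))) (suc (period s))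
  ... | no none = x , y , ¬Enlarges⇒Maximal tl none , ℤP.≤-refl , ℤP.≤-refl
  ... | yes (i , _ , j , _ , 1≤i+j , tl') with maximal-above s f (x - + i) (y + + j) tl' slack′
    where
    slack′ : x - + i + + period s ≤ y + + j + + f
    slack′ = +-cancelˡ-≤ (+ i) (subst₂ _≤_ (sym (i+[x-i+p]≡x+p (+ i) x (+ period s))) (sym (i+[y+j+f]≡y+f+[i+j] (+ i) y (+ j) (+ f)))
               (ℤP.≤-trans slack (subst (y + + suc f ≤_) (cong (λ w → y + + f + w) (ℤP.pos-+ i j))
                 (subst (_≤ y + + f + + (i ℕ.+ j)) (sym (i+suc[n]≡i+n+1 y f)) (ℤP.+-monoʳ-≤ (y + + f) (+≤+ 1≤i+j))))))
  ...   | u , v , mx , u≤x-i , y+j≤v = u , v , mx , ℤP.≤-trans u≤x-i (ℤP.i≤j⇒i-k≤j (+ i) ℤP.≤-refl) , ℤP.≤-trans (i≤i+ℕn y j) y+j≤v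

  arcOfBridgeFrom : Side → ℤ → ℤ → Arc m n
  arcOfBridgeFrom up z w = arcOfB z w
  arcOfBridgeFrom lo z w = arcOfB w z

  Lift-arcOfBridgeFrom : ∀ s z w → Lift (arcOfBridgeFrom s z w) (bridgeFrom s z w)
  Lift-arcOfBridgeFrom up z w = Lift-arcOfB z w
  Lift-arcOfBridgeFrom lo z w = Lift-arcOfB w z

  IsBridging-arcOfBridgeFrom : ∀ s z w → IsBridging (arcOfBridgeFrom s z w)
  IsBridging-arcOfBridgeFrom up z w = tt
  IsBridging-arcOfBridgeFrom lo z w = tt

  Lift-P⇒¬IsBridging : ∀ {γ s x y} → Lift γ (P s x y) → ¬ IsBridging γ
  Lift-P⇒¬IsBridging {bridge _ _} (k , ()) _

  Lift-P⇒IsPeripheral : ∀ {γ s x y} → Lift γ (P s x y) → IsPeripheral γ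
  Lift-P⇒IsPeripheral {outer _ _ _ _} _ = tt
  Lift-P⇒IsPeripheral {inner _ _ _ _} _ = tt
  Lift-P⇒IsPeripheral {bridge _ _} (k , ())

  B-¬Crosses-shift : ∀ k i j → ¬ Crosses (B i j) (shift k (B i j))
  B-¬Crosses-shift k i j (inj₁ (i<i+km , j+kn<j)) = ℤP.<-asym (0<k*M⇒0<k k m (i<i+j⇒0<j i i<i+km)) (k*M<0⇒k<0 k n (i+j<i⇒j<0 j j+kn<j))
  B-¬Crosses-shift k i j (inj₂ (i+km<i , j<j+kn)) = ℤP.<-asym (0<k*M⇒0<k k n (i<i+j⇒0<j j j<j+kn)) (k*M<0⇒k<0 k m (i+j<i⇒j<0 i i+km<i))

  bridge-self-noncrossing : ∀ {β c c'} → Lift β c → Lift β c' → IsBridging β → ¬ Crosses c c'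
  bridge-self-noncrossing {bridge a j} {c} {c'} (k1 , e1) l' _ h with Lift-related {bridge a j} (k1 , e1) l'
  ... | k , e = B-¬Crosses-shift k (+ toℕ a + k1 * + m) (j + k1 * + n)
                  (subst₂ Crosses (sym e1) (trans (sym e) (cong (shift k) (sym e1))) h)

  Lift-bridgeFrom⇒IsBridging : ∀ s {γ z w} → Lift γ (bridgeFrom s z w) → IsBridging γ
  Lift-bridgeFrom⇒IsBridging up l = Lift-B⇒IsBridging l
  Lift-bridgeFrom⇒IsBridging lo l = Lift-B⇒IsBridging l

  -- Let (u, v) be a maximal peripheral chord of T with apex z. Its endpoint u is
  -- free, so the highest bridge (u, w) from u is in T, and then so is (v, w). The
  -- flip of (u, v) is the bridging chord (z, w): it crosses (u, v) and nothing else.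
  module MaximalIsBounding (s : Side) (u v : ℤ) (mxm : Maximal s u v) where
    σ-chord : InT (P s u v)
    σ-chord = proj₁ mxm
    σ : Arc m n
    σ = proj₁ σ-chord
    σ∈T : σ ∈ T
    σ∈T = proj₁ (proj₂ σ-chord)
    lσ : Lift σ (P s u v)
    lσ = proj₂ (proj₂ σ-chord)
    σ-maximal : ∀ {x y} → InT (P s x y) → x ≤ u → v ≤ y → (x ≡ u) × (y ≡ v)
    σ-maximal = proj₂ mxm

    apx : Σ ℤ λ z → (u < z) × (z < v) × Edge s u z × Edge s z v
    apx = apex σ-chord
    z : ℤ
    z = proj₁ apx
    uz : u < z
    uz = proj₁ (proj₂ apx)
    zv : z < v
    zv = proj₁ (proj₂ (proj₂ apx))
    uz-edge : Edge s u z
    uz-edge = proj₁ (proj₂ (proj₂ (proj₂ apx)))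
    zv-edge : Edge s z v
    zv-edge = proj₂ (proj₂ (proj₂ (proj₂ apx)))

    u-free : Free s u
    u-free {x} {y} tl (a , b) with ℤP.<-cmp y v
    ... | tri< lt _ _ = InT-noncrossing σ-chord tl (refl , inj₂ (a , b , lt))
    ... | tri≈ _ e _ = ℤP.<-irrefl (proj₁ (σ-maximal tl (ℤP.<⇒≤ a) (ℤP.≤-reflexive (sym e)))) a
    ... | tri> _ _ gt = ℤP.<-irrefl (proj₁ (σ-maximal tl (ℤP.<⇒≤ a) (ℤP.<⇒≤ gt))) a

    bw : Σ ℤ λ w → InT (bridgeFrom s u w) × (∀ {i j} → InT (B i j) → coord s i j ≤ u → coord (other s) i j ≤ w)
    bw = bridgeAt s u u-free
    w : ℤ
    w = proj₁ bw
    uw∈T : InT (bridgeFrom s u w)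
    uw∈T = proj₁ (proj₂ bw)
    bound : ∀ {i j} → InT (B i j) → coord s i j ≤ u → coord (other s) i j ≤ w
    bound = proj₂ (proj₂ bw)

    ¬crosses-σ : ∀ {i j} → InT (B i j) → u < coord s i j → coord s i j < v → ⊥
    ¬crosses-σ tl a b = InT-noncrossing σ-chord tl (a , b)

    vw∈T : InT (bridgeFrom s v w)
    vw∈T = InT-bridgeFrom s v w H
      where
      H : ∀ {c'} → InT c' → ¬ Crosses (bridgeFrom s v w) c'
      H {P s' x y} tl h with bridgeFrom-P-view s s' h
      ... | inj₂ (refl , a , b) = InT-noncrossing tl uw∈T (P-other-Crosses-bridgeFrom s a b)
      ... | inj₁ (refl , a , b) with ℤP.<-cmp x u
      ...   | tri< lt _ _ = ℤP.<-irrefl (proj₁ (σ-maximal tl (ℤP.<⇒≤ lt) (ℤP.<⇒≤ b))) lt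
      ...   | tri≈ _ e _ = ℤP.<-irrefl (sym (proj₂ (σ-maximal tl (ℤP.≤-reflexive e) (ℤP.<⇒≤ b)))) b
      ...   | tri> _ _ gt = InT-noncrossing σ-chord tl (refl , inj₁ (gt , a , b))
      H {B i j} tl h with bridgeFrom-B-view s h
      ... | inj₁ (a , b) = InT-noncrossing uw∈T tl (subst (Crosses (bridgeFrom s u w)) (bridgeFrom-coord s i j) (bridgeFrom-Crosses s (inj₁ (ℤP.<-trans (ℤP.<-trans uz zv) a , b))))
      ... | inj₂ (a , b) with ℤP.<-cmp u (coord s i j)
      ...   | tri< lt _ _ = ¬crosses-σ tl lt a
      ...   | tri≈ _ e _ = ℤP.<-irrefl refl (ℤP.<-≤-trans b (bound tl (ℤP.≤-reflexive (sym e))))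
      ...   | tri> _ _ gt = ℤP.<-irrefl refl (ℤP.<-≤-trans b (bound tl (ℤP.<⇒≤ gt)))

    flip-crosses-only-σ : ∀ {c'} → InT c' → Crosses (bridgeFrom s z w) c' → c' ≡ P s u v
    flip-crosses-only-σ {P s' x y} tl h with bridgeFrom-P-view s s' h
    ... | inj₂ (refl , a , b) = ⊥-elim (InT-noncrossing tl uw∈T (P-other-Crosses-bridgeFrom s a b))
    ... | inj₁ (refl , xz , zy) with ℤP.<-cmp x u
    ...   | tri> _ _ ux = ⊥-elim (InT-noncrossing (Edge⇒InT uz-edge ux xz) tl (refl , inj₁ (ux , xz , zy)))
    ...   | tri< xu _ _ with ℤP.<-cmp y v
    ...     | tri< yv _ _ = ⊥-elim (InT-noncrossing σ-chord tl (refl , inj₂ (xu , ℤP.<-trans uz zy , yv)))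
    ...     | tri≈ _ e _ = ⊥-elim (ℤP.<-irrefl (proj₁ (σ-maximal tl (ℤP.<⇒≤ xu) (ℤP.≤-reflexive (sym e)))) xu)
    ...     | tri> _ _ vy = ⊥-elim (ℤP.<-irrefl (proj₁ (σ-maximal tl (ℤP.<⇒≤ xu) (ℤP.<⇒≤ vy))) xu)
    flip-crosses-only-σ {P s' x y} tl h | inj₁ (refl , xz , zy) | tri≈ _ refl _ with ℤP.<-cmp y v
    ...     | tri< yv _ _ = ⊥-elim (InT-noncrossing (Edge⇒InT zv-edge zy yv) tl (refl , inj₂ (xz , zy , yv)))
    ...     | tri≈ _ refl _ = refl
    ...     | tri> _ _ vy = ⊥-elim (ℤP.<-irrefl (sym (proj₂ (σ-maximal tl ℤP.≤-refl (ℤP.<⇒≤ vy)))) vy)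
    flip-crosses-only-σ {B i j} tl h with bridgeFrom-B-view s h
    ... | inj₁ (a , b) with ℤP.<-cmp (coord s i j) v
    ...   | tri< lt _ _ = ⊥-elim (InT-noncrossing (Edge⇒InT zv-edge a lt) tl (a , lt))
    ...   | tri≈ _ _ _ = ⊥-elim (InT-noncrossing uw∈T tl (subst (Crosses (bridgeFrom s u w)) (bridgeFrom-coord s i j) (bridgeFrom-Crosses s (inj₁ (ℤP.<-trans uz a , b)))))
    ...   | tri> _ _ _ = ⊥-elim (InT-noncrossing uw∈T tl (subst (Crosses (bridgeFrom s u w)) (bridgeFrom-coord s i j) (bridgeFrom-Crosses s (inj₁ (ℤP.<-trans uz a , b)))))
    flip-crosses-only-σ {B i j} tl h | inj₂ (a , b) with ℤP.<-cmp u (coord s i j)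
    ...   | tri< lt _ _ = ⊥-elim (InT-noncrossing (Edge⇒InT uz-edge lt a) tl (lt , a))
    ...   | tri≈ _ e _ = ⊥-elim (ℤP.<-irrefl refl (ℤP.<-≤-trans b (bound tl (ℤP.≤-reflexive (sym e)))))
    ...   | tri> _ _ gt = ⊥-elim (ℤP.<-irrefl refl (ℤP.<-≤-trans b (bound tl (ℤP.<⇒≤ gt))))

    crosses-σ⇒flip : ∀ g → Crosses g (P s u v) → (InT (P s u z) → ¬ Crosses g (P s u z)) → (InT (P s z v) → ¬ Crosses g (P s z v)) →
         ¬ Crosses g (bridgeFrom s u w) → ¬ Crosses g (bridgeFrom s v w) → g ≡ bridgeFrom s z w
    crosses-σ⇒flip (P s' x y) (refl , inj₁ (a , b , c)) n1 n2 n3 n4 = ⊥-elim (n3 (P-Crosses-bridgeFrom s a b))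
    crosses-σ⇒flip (P s' x y) (refl , inj₂ (a , b , c)) n1 n2 n3 n4 = ⊥-elim (n4 (P-Crosses-bridgeFrom s b c))
    crosses-σ⇒flip (B i j) (a , b) n1 n2 n3 n4 with ℤP.<-cmp (coord s i j) z
    ... | tri< lt _ _ = ⊥-elim (n1 (Edge⇒InT uz-edge a lt) (a , lt))
    ... | tri> _ _ gt = ⊥-elim (n2 (Edge⇒InT zv-edge gt b) (gt , b))
    ... | tri≈ _ e _ with ℤP.<-cmp (coord (other s) i j) w
    ...   | tri< lt _ _ = ⊥-elim (n3 (subst (λ g → Crosses g (bridgeFrom s u w)) (bridgeFrom-coord s i j) (bridgeFrom-Crosses s (inj₂ (a , lt)))))
    ...   | tri> _ _ gt = ⊥-elim (n4 (subst (λ g → Crosses g (bridgeFrom s v w)) (bridgeFrom-coord s i j) (bridgeFrom-Crosses s (inj₁ (b , gt)))))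
    ...   | tri≈ _ e' _ = trans (sym (bridgeFrom-coord s i j)) (cong₂ (bridgeFrom s) e e')

    σ' : Arc m n
    σ' = arcOfBridgeFrom s z w
    flip-lift : Lift σ' (bridgeFrom s z w)
    flip-lift = Lift-arcOfBridgeFrom s z w

    Q : Arc m n → Set
    Q τ = τ ≡ σ' ⊎ (τ ∈ T × τ ≢ σ)

    flip-noncrossing : ∀ {c c' τ'} → Lift σ' c → τ' ∈ T → Lift τ' c' → τ' ≢ σ → ¬ Crosses c c'
    flip-noncrossing {c} {c'} {τ'} l i' l' ne h with Lift-related flip-lift l
    ... | k , refl with flip-crosses-only-σ {shift (- k) c'} (τ' , i' , Lift-shift (- k) l')
                           (subst (λ g → Crosses g (shift (- k) c')) (shift-inverse k (bridgeFrom s z w)) (Crosses-shift (- k) _ _ h))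
    ...   | e = ne (Lift-injective (subst (Lift τ') e (Lift-shift (- k) l')) lσ)

    flipped-noncrossing : ∀ {c c'} → Lifted Q c → Lifted Q c' → ¬ Crosses c c'
    flipped-noncrossing (τ , inj₁ refl , l) (τ' , inj₁ refl , l') h = bridge-self-noncrossing l l' (IsBridging-arcOfBridgeFrom s z w) h
    flipped-noncrossing (τ , inj₁ refl , l) (τ' , inj₂ (i' , ne') , l') h = flip-noncrossing l i' l' ne' h
    flipped-noncrossing (τ , inj₂ (i , ne) , l) (τ' , inj₁ refl , l') h = flip-noncrossing l' i l ne (Crosses-sym _ _ h)
    flipped-noncrossing (τ , inj₂ (i , _) , l) (τ' , inj₂ (i' , _) , l') h = InT-noncrossing (τ , i , l) (τ' , i' , l') h

    flip≢σ : σ' ≢ σ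
    flip≢σ e = Lift-P⇒¬IsBridging lσ (subst IsBridging e (IsBridging-arcOfBridgeFrom s z w))

    σ-crosses-flip : Cross σ σ'
    σ-crosses-flip = Crosses⇒Cross lσ flip-lift (P-Crosses-bridgeFrom s uz zv)

    flipped-maximal : ∀ γ → (∀ τ → Q τ → Compatible γ τ) → Q γ
    flipped-maximal γ Hγ with γ ≟-Arc σ'
    ... | yes e = inj₁ e
    ... | no ne = inj₂ (γ∈T , γ≢σ)
      where
      γ≢σ : γ ≢ σ
      γ≢σ e = Hγ σ' (inj₁ refl) (subst (λ g → Cross g σ') (sym e) σ-crosses-flip)
      ¬crosses-flipped : ∀ {g c'} → Lift γ g → (tl : InT c') → proj₁ tl ≢ σ → ¬ Crosses g c'
      ¬crosses-flipped lg (β , βi , lβ) nβ h = Hγ β (inj₂ (βi , nβ)) (Crosses⇒Cross lg lβ h)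
      γ-compatible-σ : Compatible γ σ
      γ-compatible-σ cr with Cross⇒Crosses {γ} {σ} cr
      ... | t , lt , h with Lift-related lt lσ
      ...   | k , e = ne (Lift-injective lg' flip-lift)
        where
        g = shift k (canon γ)
        lg : Lift γ g
        lg = Lift-shift k (Lift-canon γ)
        hg : Crosses g (P s u v)
        hg = subst (Crosses g) e (Crosses-shift k _ _ h)
        eg : g ≡ bridgeFrom s z w
        eg = crosses-σ⇒flip g hg (λ tl → ¬crosses-flipped lg tl (≢σ-left tl)) (λ tl → ¬crosses-flipped lg tl (≢σ-right tl))
               (¬crosses-flipped lg uw∈T (λ e' → Lift-P⇒¬IsBridging lσ (subst IsBridging e' (Lift-bridgeFrom⇒IsBridging s (proj₂ (proj₂ uw∈T))))))
               (¬crosses-flipped lg vw∈T (λ e' → Lift-P⇒¬IsBridging lσ (subst IsBridging e' (Lift-bridgeFrom⇒IsBridging s (proj₂ (proj₂ vw∈T))))))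
          where
          ≢σ-left : (tl : InT (P s u z)) → proj₁ tl ≢ σ
          ≢σ-left (β , _ , lβ) refl = ℤP.<-irrefl (trans (Lift-span lβ) (sym (Lift-span lσ))) zv
          ≢σ-right : (tl : InT (P s z v)) → proj₁ tl ≢ σ
          ≢σ-right (β , _ , lβ) refl = ℤP.<-irrefl (+-cancelʳ-≡ (trans (sym (Lift-span lσ)) (Lift-span lβ))) uz
        lg' : Lift γ (bridgeFrom s z w)
        lg' = subst (Lift γ) eg lg
      γ∈T : γ ∈ T
      γ∈T = T-maximal γ λ τ τi → case τ ≟-Arc σ of λ { (yes refl) → γ-compatible-σ ; (no nτ) → Hγ τ (inj₂ (τi , nτ)) }

    flipped-triangulation : IsTriangulationP Q
    flipped-triangulation = ¬Crosses⇒Compatible flipped-noncrossing , flipped-maximal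

    bounding : IsBounding T σ
    bounding = σ∈T , Lift-P⇒IsPeripheral lσ , σ' , (flip≢σ , flipped-triangulation) , IsBridging-arcOfBridgeFrom s z w

  OnSide : Side → Arc m n → Set
  OnSide up (outer _ _ _ _) = ⊤
  OnSide lo (inner _ _ _ _) = ⊤
  OnSide _ _ = ⊥

  OnSide? : ∀ s γ → Dec (OnSide s γ)
  OnSide? up (outer _ _ _ _) = yes tt
  OnSide? up (inner _ _ _ _) = no λ ()
  OnSide? up (bridge _ _) = no λ ()
  OnSide? lo (inner _ _ _ _) = yes tt
  OnSide? lo (outer _ _ _ _) = no λ ()
  OnSide? lo (bridge _ _) = no λ ()

  Lift-P⇒OnSide : ∀ {γ s x y} → Lift γ (P s x y) → OnSide s γ
  Lift-P⇒OnSide {outer _ _ _ _} {up} _ = tt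
  Lift-P⇒OnSide {inner _ _ _ _} {lo} _ = tt
  Lift-P⇒OnSide {outer _ _ _ _} {lo} (k , ())
  Lift-P⇒OnSide {inner _ _ _ _} {up} (k , ())
  Lift-P⇒OnSide {bridge _ _} (k , ())

  canon-OnSide : ∀ s γ → OnSide s γ → Σ ℤ λ x0 → Σ ℕ λ d → canon γ ≡ P s x0 (x0 + + d)
  canon-OnSide up (outer a d _ _) _ = + toℕ a , d , refl
  canon-OnSide lo (inner a d _ _) _ = + toℕ a , d , refl

  count : Side → List (Arc m n) → ℕ
  count up = countOuter
  count lo = countInner

  count-[] : ∀ s → 0 ≡ count s []L
  count-[] up = refl
  count-[] lo = refl

  count-∷-OnSide : ∀ s γ L → OnSide s γ → count s (γ ∷L L) ≡ suc (count s L)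
  count-∷-OnSide up (outer _ _ _ _) L _ = refl
  count-∷-OnSide lo (inner _ _ _ _) L _ = refl

  count-∷-¬OnSide : ∀ s γ L → ¬ OnSide s γ → count s (γ ∷L L) ≡ count s L
  count-∷-¬OnSide up (outer _ _ _ _) L np = ⊥-elim (np tt)
  count-∷-¬OnSide up (inner _ _ _ _) L np = refl
  count-∷-¬OnSide up (bridge _ _) L np = refl
  count-∷-¬OnSide lo (outer _ _ _ _) L np = refl
  count-∷-¬OnSide lo (inner _ _ _ _) L np = ⊥-elim (np tt)
  count-∷-¬OnSide lo (bridge _ _) L np = refl

  HasApex : (s : Side) → Arc m n → Fin (period s) → Set
  HasApex s γ p = Σ ℤ λ x → Σ ℤ λ y → Lift γ (P s x y) × IsApex s x y (+ toℕ p)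

  Edge-shift : ∀ {s x y} k → Edge s x y → Edge s (x + k * + period s) (y + k * + period s)
  Edge-shift {s} {x} k (inj₁ refl) = inj₁ (+-rightComm x (+ 1) (k * + period s))
  Edge-shift k (inj₂ t) = inj₂ (Lifted-shift k t)

  IsApex-shift : ∀ {s x y z} k → IsApex s x y z → IsApex s (x + k * + period s) (y + k * + period s) (z + k * + period s)
  IsApex-shift k (tl , a , b , e1 , e2) = Lifted-shift k tl , ℤP.+-monoˡ-< _ a , ℤP.+-monoˡ-< _ b , Edge-shift k e1 , Edge-shift k e2

  HasApex-unique : ∀ {s γ p p'} → HasApex s γ p → HasApex s γ p' → p ≡ p'
  HasApex-unique {s} {γ} {p} {p'} (x , y , l , ap) (x' , y' , l' , ap') with Lift-related l l'
  ... | k , e with cong pStart e | cong pEnd e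
  ...   | e1 | e2 with apex-unique (subst₂ (λ a b → IsApex s a b (+ toℕ p + k * + period s)) e1 e2 (IsApex-shift k ap)) ap'
  ...     | e3 with r+q*M≡r′+q′*M⇒q≡q′ (period s) (toℕ p) (toℕ p') k (+ 0) (FP.toℕ<n p) (FP.toℕ<n p') (trans e3 (sym (x+0*p≡x (+ toℕ p') (+ period s))))
  ...       | refl = FP.toℕ-injective (ℤP.+-injective (trans (sym (ℤP.+-identityʳ (+ toℕ p))) e3))

  toFin : (s : Side) → ℤ → Fin (period s)
  toFin s z = F.fromℕ< (rem<period s z)

  toFin-shift : ∀ s z → + toℕ (toFin s z) ≡ z + (- quot s z) * + period s
  toFin-shift s z = trans (cong +_ (FP.toℕ-fromℕ< (rem<period s z))) (trans (sym (x+k*p+-k*p≡x (+ rem s z) (quot s z) (+ period s))) (cong (λ q → q + (- quot s z) * + period s) (sym (quot-rem s z))))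

  apex-exists : ∀ s γ → γ ∈ T → OnSide s γ → Σ (Fin (period s)) (HasApex s γ)
  apex-exists s γ γi ps with canon-OnSide s γ ps
  ... | x0 , d , ec with apex {s} {x0} {x0 + + d} (γ , γi , subst (Lift γ) ec (Lift-canon γ))
  ...   | z , az = toFin s z , _ , _ , Lift-shift (- quot s z) (subst (Lift γ) ec (Lift-canon γ)) ,
                   subst (IsApex s _ _) (sym (toFin-shift s z)) (IsApex-shift (- quot s z) ((γ , γi , subst (Lift γ) ec (Lift-canon γ)) , az))

  ApexSet : Side → List (Arc m n) → Set
  ApexSet s L = Σ (Subset (period s)) λ S → (Sub.∣ S ∣ ≡ count s L) ×
            (∀ p → p Sub.∈ S → Σ (Arc m n) λ γ → γ ∈ L × HasApex s γ p) ×
            (∀ γ → γ ∈ L → OnSide s γ → ∀ p → HasApex s γ p → p Sub.∈ S)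

  apexSet : ∀ s L → (∀ γ → γ ∈ L → γ ∈ T) → Unique L → ApexSet s L
  apexSet s []L _ _ = Sub.⊥ , trans (SubP.∣⊥∣≡0 (period s)) (count-[] s) , (λ p h → ⊥-elim (SubP.∉⊥ h)) , λ γ ()
  apexSet s (γ ∷L L) sub (γ∉ ∷ uq) with apexSet s L (λ γ' i → sub γ' (there i)) uq
  ... | S , c , h1 , h2 with OnSide? s γ
  ...   | no np = S , trans c (sym (count-∷-¬OnSide s γ L np)) , (λ p h → let (γ' , i , a) = h1 p h in γ' , there i , a) ,
                  λ { γ' (here refl) ps → ⊥-elim (np ps) ; γ' (there i) ps → h2 γ' i ps }
  ...   | yes ps with apex-exists s γ (sub γ (here refl)) ps
  ...     | p₀ , ap₀ = insert p₀ S , trans (∉⇒∣insert∣≡suc p₀ S p₀∉) (trans (cong suc c) (sym (count-∷-OnSide s γ L ps))) , apex∈S , apexes⊆S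
    where
    p₀∉ : ¬ (p₀ Sub.∈ S)
    p₀∉ h with h1 p₀ h
    ... | γ' , i , (x' , y' , l' , ap') with apex-determines-chord (proj₂ (proj₂ (proj₂ ap₀))) ap'
    ...   | refl , refl = AllP.lookup γ∉ i (Lift-injective (proj₁ (proj₂ (proj₂ ap₀))) l')
    apex∈S : ∀ p → p Sub.∈ insert p₀ S → Σ (Arc m n) λ γ' → γ' ∈ (γ ∷L L) × HasApex s γ' p
    apex∈S p h with ∈insert⁻ p₀ p S h
    ... | inj₁ refl = γ , here refl , ap₀
    ... | inj₂ h' = let (γ' , i , a) = h1 p h' in γ' , there i , a
    apexes⊆S : ∀ γ' → γ' ∈ (γ ∷L L) → OnSide s γ' → ∀ p → HasApex s γ' p → p Sub.∈ insert p₀ S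
    apexes⊆S γ' (here refl) _ p a = subst (Sub._∈ insert p₀ S) (HasApex-unique ap₀ a) (x∈insert[x] p₀ S)
    apexes⊆S γ' (there i) ps' p a = ∈⇒∈insert p₀ p S (h2 γ' i ps' p a)

  -- The non-free points are the apexes of the peripheral arcs of T on side s.
  nonFree-count : ∀ s → Unique T → Σ (Subset (period s)) λ S → (Sub.∣ S ∣ ≡ count s T) ×
              (∀ p → p Sub.∈ S → ¬ Free s (+ toℕ p)) × (∀ p → ¬ (p Sub.∈ S) → Free s (+ toℕ p))
  nonFree-count s uq with apexSet s T (λ γ i → i) uq
  ... | S , c , h1 , h2 = S , c , apex⇒¬Free , ¬apex⇒Free
    where
    apex⇒¬Free : ∀ p → p Sub.∈ S → ¬ Free s (+ toℕ p)
    apex⇒¬Free p h fr with h1 p h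
    ... | γ , γi , x , y , l , (tl , a , b , _) = fr tl (a , b)
    ¬apex⇒Free : ∀ p → ¬ (p Sub.∈ S) → Free s (+ toℕ p)
    ¬apex⇒Free p np {x} {y} tl (a , b) with descend-to-apex (period s) x y (+ toℕ p) tl (InT-P-≤period tl) a b
    ... | x' , y' , ap@((β , βi , lβ) , _) = np (h2 β βi (Lift-P⇒OnSide lβ) p (x' , y' , lβ , ap))

  Free-shift : ∀ {s z} k → Free s z → Free s (z + k * + period s)
  Free-shift {s} {z} k fr {x} {y} tl (a , b) =
    fr (Lifted-shift (- k) tl) (subst (x + - k * + period s <_) (x+k*p+-k*p≡x z k (+ period s)) (ℤP.+-monoˡ-< (- k * + period s) a) ,
                           subst (_< y + - k * + period s) (x+k*p+-k*p≡x z k (+ period s)) (ℤP.+-monoˡ-< (- k * + period s) b))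

  free-point : ∀ s → Σ (Fin (period s)) λ p → Free s (+ toℕ p)
  free-point s with free-exists s
  ... | z , fr = toFin s z , subst (Free s) (sym (toFin-shift s z)) (Free-shift (- quot s z) fr)

  StrictlyInside : (s : Side) → Fin (period s) → Arc m n → Set
  StrictlyInside up p σ = StrictlyInsideOuter p σ
  StrictlyInside lo p σ = StrictlyInsideInner p σ

  Removed : (s : Side) → Fin (period s) → Set
  Removed s p = ∃ λ σ → IsBounding T σ × StrictlyInside s p σ

  StrictlyInside⇒¬Free : ∀ s p σ → σ ∈ T → StrictlyInside s p σ → ¬ Free s (+ toℕ p)
  StrictlyInside⇒¬Free up p (outer a d x y) σi (t , q , t1 , td , e) fr =
    fr (Lifted-shift (- + q) (outer a d x y , σi , Lift-canon (outer a d x y))) (strictlyInside⇒between (toℕ a) d (toℕ p) m t q t1 td e)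
  StrictlyInside⇒¬Free lo p (inner a d x y) σi (t , q , t1 , td , e) fr =
    fr (Lifted-shift (- + q) (inner a d x y , σi , Lift-canon (inner a d x y))) (strictlyInside⇒between (toℕ a) d (toℕ p) n t q t1 td e)

  between⇒StrictlyInside : ∀ s p σ {u v} → Lift σ (P s u v) → u < + toℕ p → + toℕ p < v → StrictlyInside s p σ
  between⇒StrictlyInside up p (outer a d _ _) (k , refl) h1 h2 = between⇒strictlyInside (toℕ a) d (toℕ p) m k (FP.toℕ<n p) h1 h2
  between⇒StrictlyInside lo p (inner a d _ _) (k , refl) h1 h2 = between⇒strictlyInside (toℕ a) d (toℕ p) n k (FP.toℕ<n p) h1 h2
  between⇒StrictlyInside up p (inner _ _ _ _) (k , ())
  between⇒StrictlyInside up p (bridge _ _) (k , ())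
  between⇒StrictlyInside lo p (outer _ _ _ _) (k , ())
  between⇒StrictlyInside lo p (bridge _ _) (k , ())

  bounding-above : ∀ s x y z → InT (P s x y) → x < z → z < y →
               Σ (Arc m n) λ σ → IsBounding T σ × Σ ℤ λ u → Σ ℤ λ v → Lift σ (P s u v) × (u < z) × (z < v)
  bounding-above s x y z tl a b with maximal-above s (period s) x y tl (ℤP.+-monoˡ-≤ (+ period s) (ℤP.<⇒≤ (ℤP.<-trans a b)))
  ... | u , v , mxm , ux , yv = MaximalIsBounding.σ s u v mxm , MaximalIsBounding.bounding s u v mxm , u , v , MaximalIsBounding.lσ s u v mxm ,
                                 ℤP.≤-<-trans ux a , ℤP.<-≤-trans b yv

  Free⇔¬Removed : ∀ s p → (Free s (+ toℕ p) → ¬ Removed s p) × (¬ Removed s p → Free s (+ toℕ p))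
  Free⇔¬Removed s p = (λ fr (σ , bd , si) → StrictlyInside⇒¬Free s p σ (proj₁ bd) si fr) ,
                    λ nr tl (a , b) → let (σ , bd , u , v , l , h1 , h2) = bounding-above s _ _ _ tl a b in nr (σ , bd , between⇒StrictlyInside s p σ l h1 h2)

  module Remaining (uq : Unique T) (s : Side) (R : Subset (period s)) (hR : ∀ p → (p Sub.∈ R → ¬ Removed s p) × (¬ Removed s p → p Sub.∈ R)) where
    ∈⇒Free : ∀ p → p Sub.∈ R → Free s (+ toℕ p)
    ∈⇒Free p h = proj₂ (Free⇔¬Removed s p) (proj₁ (hR p) h)

    Free⇒∈ : ∀ p → Free s (+ toℕ p) → p Sub.∈ R
    Free⇒∈ p fr = proj₂ (hR p) (proj₁ (Free⇔¬Removed s p) fr)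

    ∣R∣≡period∸count : Sub.∣ R ∣ ≡ period s ℕ.∸ count s T
    ∣R∣≡period∸count with nonFree-count s uq
    ... | S , c , apex⇒¬Free , ¬apex⇒Free = trans (cong Sub.∣_∣ eqR) (trans (SubP.∣∁p∣≡n∸∣p∣ S) (cong (period s ℕ.∸_) c))
      where
      eqR : R ≡ Sub.∁ S
      eqR = SubP.⊆-antisym (λ {p} h → SubP.x∉p⇒x∈∁p (λ hs → apex⇒¬Free p hs (∈⇒Free p h)))
                           (λ {p} h → Free⇒∈ p (¬apex⇒Free p (SubP.x∈∁p⇒x∉p h)))

    count<period : count s T ℕ.< period s
    count<period with free-point s
    ... | p , fr = ℕP.≰⇒> λ ge → ℕP.<-irrefl refl (ℕP.<-≤-trans (ℕP.≤-trans (s≤s z≤n) (SubP.x∈p⇒∣p-x∣<∣p∣ (Free⇒∈ p fr)))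
                      (ℕP.≤-reflexive (trans ∣R∣≡period∸count (ℕP.m≤n⇒m∸n≡0 ge))))

  InT-B⇒Free : ∀ s {i j} → InT (B i j) → Free s (coord s i j)
  InT-B⇒Free s tl tl' h = InT-noncrossing tl' tl h

  module Skeleton (uq : Unique T) (Ro : Subset m) (Ri : Subset n)
              (hRo : IsRemainingOuter T Ro) (hRi : IsRemainingInner T Ri) where

    Rs : (s : Side) → Subset (period s)
    Rs up = Ro
    Rs lo = Ri

    Rs-remaining : ∀ s p → (p Sub.∈ Rs s → ¬ Removed s p) × (¬ Removed s p → p Sub.∈ Rs s)
    Rs-remaining up = hRo
    Rs-remaining lo = hRi

    module Rem (s : Side) = Remaining uq s (Rs s) (Rs-remaining s)

    m' n' : ℕ
    m' = Sub.∣ Ro ∣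
    n' = Sub.∣ Ri ∣

    ∣Rs∣>0 : ∀ s → 0 ℕ.< Sub.∣ Rs s ∣
    ∣Rs∣>0 s = subst (0 ℕ.<_) (sym (Rem.∣R∣≡period∸count s)) (ℕP.m<n⇒0<n∸m (Rem.count<period s))

    instance
      nzm' : NonZero m'
      nzm' = ℕ.>-nonZero (∣Rs∣>0 up)
      nzn' : NonZero n'
      nzn' = ℕ.>-nonZero (∣Rs∣>0 lo)

    module Strip′ = Strip m' n'
    module LiftedArcs′ = LiftedArcs m' n'

    module RelabelOuter = Relabel m Ro
    module RelabelInner = Relabel n Ri

    period′ : Side → ℕ
    period′ s = Sub.∣ Rs s ∣

    rel : Side → ℤ → ℤ
    rel up = relabel m Ro
    rel lo = relabel n Ri

    Survives : Side → ℤ → Set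
    Survives s z = toFin s z Sub.∈ Rs s

    Survives⇒Free : ∀ s {z} → Survives s z → Free s z
    Survives⇒Free s {z} h = subst (Free s) (trans (cong (λ w → w + quot s z * + period s) (toFin-shift s z)) (x+-k*p+k*p≡x z (quot s z) (+ period s)))
                         (Free-shift (quot s z) (Rem.∈⇒Free s (toFin s z) h))

    Free⇒Survives : ∀ s {z} → Free s z → Survives s z
    Free⇒Survives s {z} fr = Rem.Free⇒∈ s (toFin s z) (subst (Free s) (sym (toFin-shift s z)) (Free-shift (- quot s z) fr))

    rel-shift : ∀ s z k → rel s (z + k * + period s) ≡ rel s z + k * + period′ s
    rel-shift up = RelabelOuter.relabel-shift
    rel-shift lo = RelabelInner.relabel-shift

    rel-< : ∀ s {z z'} → Survives s z → z < z' → rel s z < rel s z'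
    rel-< up = RelabelOuter.relabel-<
    rel-< lo = RelabelInner.relabel-<

    rel-<⁻ : ∀ s {z z'} → Survives s z' → rel s z < rel s z' → z < z'
    rel-<⁻ up = RelabelOuter.relabel-<⁻
    rel-<⁻ lo = RelabelInner.relabel-<⁻

    rel-surjective : ∀ s Z → Σ ℤ λ z → Survives s z × rel s z ≡ Z
    rel-surjective up = RelabelOuter.relabel-surjective
    rel-surjective lo = RelabelInner.relabel-surjective

    IsSkeletal : Arc m' n' → Set
    IsSkeletal = Skeletal T Ro Ri

    LiftOf⇒Lift : ∀ {β I J} → LiftOf β I J → Strip′.Lift β (Strip′.B I J)
    LiftOf⇒Lift {bridge a j} (k , e1 , e2) = k , cong₂ Strip′.B e1 e2

    Lift⇒LiftOf : ∀ {β I J} → Strip′.Lift β (Strip′.B I J) → LiftOf β I J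
    Lift⇒LiftOf {bridge a j} (k , e) = k , cong Strip′.bTop e , cong Strip′.bBottom e
    Lift⇒LiftOf {outer _ _ _ _} (k , ())
    Lift⇒LiftOf {inner _ _ _ _} (k , ())

    skeletal-of-InT : ∀ {i j} → InT (B i j) → Σ (Arc m' n') λ τs → IsSkeletal τs × Strip′.Lift τs (Strip′.B (rel up i) (rel lo j))
    skeletal-of-InT (γ , γi , l) with Lift-B-view up l
    ... | a0 , j0 , k , refl , e1 , e2 = τs , (a0 , j0 , γi , Lift⇒LiftOf {LiftedArcs′.arcOfB I0 J0} {I0} {J0} (LiftedArcs′.Lift-arcOfB I0 J0)) ,
          subst (Strip′.Lift τs) (cong₂ Strip′.B (trans (sym (rel-shift up (+ toℕ a0) k)) (cong (rel up) (sym e1)))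
                                          (trans (sym (rel-shift lo j0 k)) (cong (rel lo) (sym e2))))
            (Strip′.Lift-shift {LiftedArcs′.arcOfB I0 J0} {Strip′.B I0 J0} k (LiftedArcs′.Lift-arcOfB I0 J0))
      where
      I0 J0 : ℤ
      I0 = rel up (+ toℕ a0)
      J0 = rel lo j0
      τs : Arc m' n'
      τs = LiftedArcs′.arcOfB I0 J0

    skeletal-noncrossing : ∀ β β' → IsSkeletal β → IsSkeletal β' → Compatible β β'
    skeletal-noncrossing β β' (a , j , ai , lo1) (a' , j' , ai' , lo2) cr with Strip′.Cross⇒Crosses-lifts (LiftOf⇒Lift lo1) (LiftOf⇒Lift lo2) cr
    ... | k , h = InT-noncrossing tl1 tl2 lifts-cross
      where
      tl1 : InT (B (+ toℕ a) j)
      tl1 = bridge a j , ai , Lift-canon (bridge a j)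
      tl2 : InT (B (+ toℕ a' + k * + m) (j' + k * + n))
      tl2 = Lifted-shift k (bridge a' j' , ai' , Lift-canon (bridge a' j'))
      ¬apex⇒Free j2 : ℤ
      ¬apex⇒Free = + toℕ a' + k * + m
      j2 = j' + k * + n
      h' : Strip′.Crosses (Strip′.B (rel up (+ toℕ a)) (rel lo j)) (Strip′.B (rel up ¬apex⇒Free) (rel lo j2))
      h' = subst (Strip′.Crosses (Strip′.B (rel up (+ toℕ a)) (rel lo j))) (cong₂ Strip′.B (sym (rel-shift up (+ toℕ a') k)) (sym (rel-shift lo j' k))) h
      s1 : Survives up (+ toℕ a)
      s1 = Free⇒Survives up (InT-B⇒Free up tl1)
      s2 : Survives up ¬apex⇒Free
      s2 = Free⇒Survives up (InT-B⇒Free up tl2)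
      s3 : Survives lo j
      s3 = Free⇒Survives lo (InT-B⇒Free lo tl1)
      s4 : Survives lo j2
      s4 = Free⇒Survives lo (InT-B⇒Free lo tl2)
      lifts-cross : Crosses (B (+ toℕ a) j) (B ¬apex⇒Free j2)
      lifts-cross with h'
      ... | inj₁ (x , y) = inj₁ (rel-<⁻ up s2 x , rel-<⁻ lo s3 y)
      ... | inj₂ (x , y) = inj₂ (rel-<⁻ up s1 x , rel-<⁻ lo s4 y)

    -- Every marked point of the skeleton is an endpoint of a skeletal bridging arc
    -- (the highest bridge at the corresponding free point), which crosses every
    -- peripheral arc over the next point.
    no-outer-free : ∀ a' d' .(p : 2 ℕ.≤ d') .(q : d' ℕ.≤ m') → (∀ τ → IsSkeletal τ → Compatible (outer a' d' p q) τ) → ⊥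
    no-outer-free a' d' p q Hγ =
      let (z , sv , e) = rel-surjective up (+ toℕ a' + + 1)
          (w , tl , _) = bridgeAt up z (Survives⇒Free up sv)
          (τs , sk , lτ) = skeletal-of-InT tl
          h : Strip′.Crosses (Strip′.P up (+ toℕ a') (+ toℕ a' + + d')) (Strip′.B (rel up z) (rel lo w))
          h = subst (+ toℕ a' <_) (sym e) (i<i+ℕn (+ toℕ a') ℕP.≤-refl) ,
              subst (_< + toℕ a' + + d') (sym e) (+ℕ-monoʳ-< (+ toℕ a') (recompute (2 ℕ.≤? d') p))
      in Hγ τs sk (Strip′.Crosses⇒Cross {outer a' d' p q} (Strip′.Lift-canon (outer a' d' p q)) lτ h)

    no-inner-free : ∀ b' d' .(p : 2 ℕ.≤ d') .(q : d' ℕ.≤ n') → (∀ τ → IsSkeletal τ → Compatible (inner b' d' p q) τ) → ⊥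
    no-inner-free b' d' p q Hγ =
      let (w , sv , e) = rel-surjective lo (+ toℕ b' + + 1)
          (z , tl , _) = bridgeAt lo w (Survives⇒Free lo sv)
          (τs , sk , lτ) = skeletal-of-InT tl
          h : Strip′.Crosses (Strip′.P lo (+ toℕ b') (+ toℕ b' + + d')) (Strip′.B (rel up z) (rel lo w))
          h = subst (+ toℕ b' <_) (sym e) (i<i+ℕn (+ toℕ b') ℕP.≤-refl) ,
              subst (_< + toℕ b' + + d') (sym e) (+ℕ-monoʳ-< (+ toℕ b') (recompute (2 ℕ.≤? d') p))
      in Hγ τs sk (Strip′.Crosses⇒Cross {inner b' d' p q} (Strip′.Lift-canon (inner b' d' p q)) lτ h)

    bridge-free-of-InT : ∀ a' j' z w → Survives up z → Survives lo w → rel up z ≡ + toℕ a' → rel lo w ≡ j' →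
              (∀ τ → IsSkeletal τ → Compatible (bridge a' j') τ) → ∀ {c'} → InT c' → ¬ Crosses (B z w) c'
    bridge-free-of-InT a' j' z w svz svw ez ew Hγ {P up x y} tl h = Survives⇒Free up svz tl h
    bridge-free-of-InT a' j' z w svz svw ez ew Hγ {P lo x y} tl h = Survives⇒Free lo svw tl h
    bridge-free-of-InT a' j' z w svz svw ez ew Hγ {B i j} tl h =
      let (τs , sk , lτ) = skeletal-of-InT tl
      in Hγ τs sk (Strip′.Crosses⇒Cross {bridge a' j'} (Strip′.Lift-canon (bridge a' j')) lτ
                     (relabelled-Crosses (Free⇒Survives up (InT-B⇒Free up tl)) (Free⇒Survives lo (InT-B⇒Free lo tl)) h))
      where
      relabelled-Crosses : ∀ {i j} → Survives up i → Survives lo j → Crosses (B z w) (B i j) → Strip′.Crosses (Strip′.B (+ toℕ a') j') (Strip′.B (rel up i) (rel lo j))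
      relabelled-Crosses {i} {j} svi svj (inj₁ (x , y)) = inj₁ (subst (_< rel up i) ez (rel-< up svz x) , subst (rel lo j <_) ew (rel-< lo svj y))
      relabelled-Crosses {i} {j} svi svj (inj₂ (x , y)) = inj₂ (subst (rel up i <_) ez (rel-< up svi x) , subst (_< rel lo j) ew (rel-< lo svw y))

    skeletal-of-InT-B : ∀ a' j' z w → rel up z ≡ + toℕ a' → rel lo w ≡ j' → InT (B z w) → IsSkeletal (bridge a' j')
    skeletal-of-InT-B a' j' z w ez ew (β0 , β0∈T , lβ0) with Lift-B-view up lβ0
    ... | a0 , j0 , k , refl , e1 , e2 = a0 , j0 , β0∈T , - k , top≡ , bottom≡
      where
      top≡ : + toℕ a' + - k * + m' ≡ rel up (+ toℕ a0)
      top≡ = trans (cong (λ v → v + - k * + m') (sym ez))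
               (trans (sym (rel-shift up z (- k))) (cong (rel up) (trans (cong (λ v → v + - k * + m) e1) (x+k*p+-k*p≡x (+ toℕ a0) k (+ m)))))
      bottom≡ : j' + - k * + n' ≡ rel lo j0
      bottom≡ = trans (cong (λ v → v + - k * + n') (sym ew))
                  (trans (sym (rel-shift lo w (- k))) (cong (rel lo) (trans (cong (λ v → v + - k * + n) e2) (x+k*p+-k*p≡x j0 k (+ n)))))

    skeletal-maximal : ∀ γ → (∀ τ → IsSkeletal τ → Compatible γ τ) → IsSkeletal γ
    skeletal-maximal (outer a' d' p q) Hγ = ⊥-elim (no-outer-free a' d' p q Hγ)
    skeletal-maximal (inner b' d' p q) Hγ = ⊥-elim (no-inner-free b' d' p q Hγ)
    skeletal-maximal (bridge a' j') Hγ =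
      let (z , svz , ez) = rel-surjective up (+ toℕ a')
          (w , svw , ew) = rel-surjective lo j'
      in skeletal-of-InT-B a' j' z w ez ew (InT-B z w (bridge-free-of-InT a' j' z w svz svw ez ew Hγ))

    skeletal-triangulation : IsTriangulationP IsSkeletal
    skeletal-triangulation = skeletal-noncrossing , skeletal-maximal

open import Data.Nat using (_<_; _+_; _∸_)
open import Data.Fin.Subset using (∣_∣)

lemma3p8 : (m n : ℕ) {{_ : NonZero m}} {{_ : NonZero n}}
    (T : List (Arc m n)) → IsTriangulation T →
    (k k₁ k₂ : ℕ) → countOuter T ≡ k₁ → countInner T ≡ k₂ → k₁ + k₂ ≡ k →
    (Ro : Subset m) (Ri : Subset n) →
    IsRemainingOuter T Ro → IsRemainingInner T Ri →
    (k₁ < m) × (k₂ < n) × (∣ Ro ∣ ≡ m ∸ k₁) × (∣ Ri ∣ ≡ n ∸ k₂) ×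
    IsTriangulationP (Skeletal T Ro Ri)
lemma3p8 m n T (unique , noncrossing , maximal) k k₁ k₂ refl refl refl Ro Ri hRo hRi =
  Rem.count<period up , Rem.count<period lo , Rem.∣R∣≡period∸count up , Rem.∣R∣≡period∸count lo , skeletal-triangulation
  where open Triangulated.Skeleton m n T noncrossing maximal unique Ro Ri hRo hRi
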